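{- Let $k\geq 2$. Every $k$-uniform local arc $\mathcal{S}$ in $\mathrm{PG}(2,q)$ has size $\left|\bigcup_{S\in\mathcal{S}}S\right|$ at most \[ k\left\lfloor\frac{4(k-1)+(3k-5)q+\sqrt{q\left(8(k-1)(q^2+k-2)-q(7k^2-10k-1)\right)}}{2k(k-1)}\right\rfloor. \]
   Context: $\mathrm{PG}(2,q)$ is the classical projective plane of order $q$. An arc is a set of points no three collinear. A local arc is a collection $\mathcal{S}$ of point sets such that for distinct $S_i,S_j\in\mathcal{S}$, $S_i\cap S_j=\emptyset$ and $S_i\cup S_j$ is an arc; it is $k$-uniform if all members have exactly $k$ points. -}

module Defs where

open import Level using (0ℓ)
open import Algebra.Bundles using (CommutativeRing)
open import Data.Nat as ℕ using (ℕ)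
open import Data.Fin using (Fin)
open import Data.Integer as ℤ using (ℤ; +_)
open import Data.Product using (Σ; ∃; _×_; _,_)
open import Data.Sum using (_⊎_)
open import Data.Vec.Functional using (_++_)
open import Relation.Nullary using (¬_)
open import Relation.Binary.PropositionalEquality using (_≡_)

record FiniteField (q : ℕ) : Set₁ where
  field
    commRing : CommutativeRing 0ℓ 0ℓ
  open CommutativeRing commRing public
  field
    1≉0      : ¬ (1# ≈ 0#)
    inverse  : ∀ x → ¬ (x ≈ 0#) → Σ Carrier (λ y → (x * y) ≈ 1#)
    enum     : Fin q → Carrier
    enum-inj : ∀ i j → enum i ≈ enum j → i ≡ j
    enum-sur : ∀ x → Σ (Fin q) (λ i → enum i ≈ x)

-- The projective plane PG(2,q) over a finite field F of order q:
-- points are nonzero vectors of F³, up to nonzero scalar multiples.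

module PG2 {q : ℕ} (F : FiniteField q) where
  open FiniteField F

  Vec3 : Set
  Vec3 = Carrier × Carrier × Carrier

  IsZero3 : Vec3 → Set
  IsZero3 (a , b , c) = (a ≈ 0#) × (b ≈ 0#) × (c ≈ 0#)

  record Point : Set where
    constructor pt
    field
      coords  : Vec3
      nonzero : ¬ IsZero3 coords
  open Point public

  SamePoint : Point → Point → Set
  SamePoint P Q with coords P | coords Q
  ... | (a , b , c) | (d , e , f) =
    Σ Carrier λ t → ¬ (t ≈ 0#) × (a ≈ (t * d)) × (b ≈ (t * e)) × (c ≈ (t * f))

  det3 : Vec3 → Vec3 → Vec3 → Carrier
  det3 (a₁ , a₂ , a₃) (b₁ , b₂ , b₃) (c₁ , c₂ , c₃) =
    ((a₁ * ((b₂ * c₃) - (b₃ * c₂))) - (a₂ * ((b₁ * c₃) - (b₃ * c₁))))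
      + (a₃ * ((b₁ * c₂) - (b₂ * c₁)))

  -- three points of PG(2,q) are collinear iff their coordinate vectors are
  -- linearly dependent, i.e. the determinant vanishes
  Collinear : Point → Point → Point → Set
  Collinear P Q R = det3 (coords P) (coords Q) (coords R) ≈ 0#

  DistinctPoints : ∀ {n} → (Fin n → Point) → Set
  DistinctPoints {n} P = ∀ (i j : Fin n) → ¬ (i ≡ j) → ¬ SamePoint (P i) (P j)

  IsArc : ∀ {n} → (Fin n → Point) → Set
  IsArc {n} P =
    DistinctPoints P ×
    (∀ (i j l : Fin n) → ¬ (i ≡ j) → ¬ (j ≡ l) → ¬ (i ≡ l) →
       ¬ Collinear (P i) (P j) (P l))

  -- A k-uniform local arc with m members: m sets S₀,…,S_{m-1}, each of
  -- exactly k (distinct) points, such that for distinct members S_i, S_j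
  -- we have S_i ∩ S_j = ∅ and S_i ∪ S_j is an arc.
  IsUniformLocalArc : (k m : ℕ) → (Fin m → Fin k → Point) → Set
  IsUniformLocalArc k m S =
    (∀ i → DistinctPoints (S i)) ×
    (∀ (i j : Fin m) → ¬ (i ≡ j) →
       (∀ (a b : Fin k) → ¬ SamePoint (S i a) (S j b)) ×
       IsArc (S i ++ S j))

-- The floor of (A + √B) / C (for C > 0, B ≥ 0) over the integers:
-- f is the floor iff  C·f ≤ A + √B < C·(f+1), which we express without
-- square roots.

IsFloorOfSqrtExpr : (A B C f : ℤ) → Set
IsFloorOfSqrtExpr A B C f =
  -- C·f - A ≤ √B
  ((C ℤ.* f ℤ.- A ℤ.≤ + 0) ⊎ ((C ℤ.* f ℤ.- A) ℤ.* (C ℤ.* f ℤ.- A) ℤ.≤ B)) ×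
  -- √B < C·(f+1) - A
  ((+ 0 ℤ.< C ℤ.* (f ℤ.+ + 1) ℤ.- A) ×
   (B ℤ.< (C ℤ.* (f ℤ.+ + 1) ℤ.- A) ℤ.* (C ℤ.* (f ℤ.+ + 1) ℤ.- A)))

boundA : ℕ → ℕ → ℤ
boundA k q = (+ 4 ℤ.* (+ k ℤ.- + 1)) ℤ.+ ((+ 3 ℤ.* + k ℤ.- + 5) ℤ.* + q)

boundB : ℕ → ℕ → ℤ
boundB k q =
  + q ℤ.* ((+ 8 ℤ.* (+ k ℤ.- + 1) ℤ.* (+ q ℤ.* + q ℤ.+ + k ℤ.- + 2))
           ℤ.- (+ q ℤ.* (+ 7 ℤ.* + k ℤ.* + k ℤ.- + 10 ℤ.* + k ℤ.- + 1)))

boundC : ℕ → ℤ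
boundC k = + 2 ℤ.* + k ℤ.* (+ k ℤ.- + 1)

{-# OPTIONS --safe #-}
-- Count incidences between the N = q² + q + 1 lines of PG(2,q) and the n = mk points of the local arc.
-- A line through two points of one member S_j contains no other point of the union: a third point,
-- together with any second member, would give three collinear points in the union of two members.
-- So the m·k(k-1)/2 such secant lines each carry exactly two points, and on every other line any two
-- points of the union lie in different members. Writing i(L) for the number of points on L, the
-- nonsecant lines number N₀ = N - mk(k-1)/2 and satisfy Σ i = mk(q + 2 - k) and Σ i² ≤ Σ i + m(m-1)k²,
-- so Cauchy–Schwarz (Σ i)² ≤ N₀ Σ i² is a quadratic inequality in m whose solution is the bound.
-- For m ≤ 1 it remains to see that the bound is at least 1.
module Submission where

open import Defs

module IntegerBound where
  open import Data.Nat.Base as ℕ using (ℕ; z≤n)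
  import Data.Nat.Properties as ℕ using (<⇒≤)
  open import Data.Integer.Base
  open import Data.Integer.Properties
  open import Data.Integer.Tactic.RingSolver using (solve-∀)
  open import Data.Product.Base using (_,_)
  open import Data.Sum.Base using (_⊎_; inj₁; inj₂; [_,_]′)
  open import Relation.Binary.PropositionalEquality
  open import Relation.Nullary.Negation using (contradiction)

  0≤+ : ∀ n → 0ℤ ≤ + n
  0≤+ n = +≤+ z≤n

  0≤-+ : ∀ {i j} → 0ℤ ≤ i → 0ℤ ≤ j → 0ℤ ≤ i + j
  0≤-+ = +-mono-≤

  0≤-* : ∀ {i j} → 0ℤ ≤ i → 0ℤ ≤ j → 0ℤ ≤ i * j
  0≤-* {+ m} {+ n} _ _ = subst (0ℤ ≤_) (pos-* m n) (0≤+ (m ℕ.* n))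

  0≤j-i⇒i≤j : ∀ {i j} → 0ℤ ≤ j - i → i ≤ j
  0≤j-i⇒i≤j {i} {j} 0≤j-i = subst₂ _≤_ (+-identityʳ i) (cancel i j) (+-monoʳ-≤ i 0≤j-i)
    where
    cancel : ∀ i j → i + (j - i) ≡ j
    cancel = solve-∀

  0<n⇒0≤n*i⇒0≤i : ∀ {n i} → 0ℤ < n → 0ℤ ≤ n * i → 0ℤ ≤ i
  0<n⇒0≤n*i⇒0≤i {i = + _}      _          _  = 0≤+ _
  0<n⇒0≤n*i⇒0≤i {+[1+ _ ]} { -[1+ _ ]} _  ()
  0<n⇒0≤n*i⇒0≤i {+0}       { -[1+ _ ]} (+<+ ())

  square-mono-≤ : ∀ {i j} → 0ℤ ≤ i → i ≤ j → i * i ≤ j * j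
  square-mono-≤ {i} {j} 0≤i i≤j = 0≤j-i⇒i≤j (subst (0ℤ ≤_) (difference i j)
    (0≤-* (i≤j⇒0≤j-i i≤j) (0≤-+ (0≤-+ (i≤j⇒0≤j-i i≤j) 0≤i) 0≤i)))
    where
    difference : ∀ i j → (j - i) * ((j - i + i) + i) ≡ j * j - i * i
    difference = solve-∀

  ≤-floor : ∀ {A B C f} m → 0ℤ ≤ C → C * m - A ≤ 0ℤ ⊎ (C * m - A) * (C * m - A) ≤ B →
            IsFloorOfSqrtExpr A B C f → m ≤ f
  ≤-floor {A} {B} {C} {f} m 0≤C Cm≤A+√B (_ , 0<D , B<D²) = ≮⇒≥ λ f<m →
    [ (λ E≤0 → <⇒≱ (<-≤-trans 0<D (D≤E f<m)) E≤0)
    , (λ E²≤B → <⇒≱ (<-≤-trans B<D² (square-mono-≤ (<⇒≤ 0<D) (D≤E f<m))) E²≤B)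
    ]′ Cm≤A+√B
    where
    D E : ℤ
    D = C * (f + 1ℤ) - A
    E = C * m - A
    step : ∀ C m f A → C * (m - (1ℤ + f)) ≡ (C * m - A) - (C * (f + 1ℤ) - A)
    step = solve-∀
    D≤E : f < m → D ≤ E
    D≤E f<m = 0≤j-i⇒i≤j (subst (0ℤ ≤_) (step C m f A)
                (0≤-* 0≤C (i≤j⇒0≤j-i (i<j⇒suc[i]≤j f<m))))

  -- with u = k - 1 one has 3 (C - A) = (3u - 2) (2u - 3q) - 2u, so C > A forces 2u > 3q
  C>A⇒2k≥3q+3 : ∀ {k q} → 2 ℕ.≤ k → 0ℤ < boundC k * 1ℤ - boundA k q →
                0ℤ ≤ + 2 * + k - + 3 * + q - + 3
  C>A⇒2k≥3q+3 {k} {q} 2≤k 0<C-A = ≮⇒≥ λ r<0 → contradiction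
    (subst (0ℤ ≤_) (certificate (+ k) (+ q))
      (0≤-+ (0≤-+ (0≤-* (0≤+ 3) (i≤j⇒0≤j-i (i<j⇒suc[i]≤j 0<C-A)))
                  (0≤-* (0≤-+ (0≤-* (0≤+ 3) 0≤k-2) (0≤+ 1)) (i≤j⇒0≤j-i (i<j⇒suc[i]≤j r<0))))
            (0≤-* (0≤+ 2) 0≤k-2)))
    λ ()
    where
    0≤k-2 : 0ℤ ≤ + k - + 2
    0≤k-2 = i≤j⇒0≤j-i (+≤+ 2≤k)
    certificate : ∀ K Q →
      + 3 * ((+ 2 * K * (K - + 1) * 1ℤ - ((+ 4 * (K - + 1)) + ((+ 3 * K - + 5) * Q))) - (1ℤ + 0ℤ))
      + (+ 3 * (K - + 2) + + 1) * (0ℤ - (1ℤ + (+ 2 * K - + 3 * Q - + 3))) + + 2 * (K - + 2) ≡ - + 5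
    certificate = solve-∀

  -- in terms of s = q - 2 ≥ 0 and r = 2k - 3q - 3 ≥ 0, -4B is a polynomial with nonnegative coefficients
  -- and constant term 76
  2k≥3q+3⇒B<0 : ∀ {k q} → 2 ℕ.≤ q → 0ℤ ≤ + 2 * + k - + 3 * + q - + 3 → boundB k q < 0ℤ
  2k≥3q+3⇒B<0 {k} {q} 2≤q 0≤r = ≰⇒> λ 0≤B → contradiction
    (subst (0ℤ ≤_) (certificate (+ k) (+ q))
      (0≤-+ (0≤-* (0≤+ 4) 0≤B)
            (0≤-+ (0≤-* (0≤-+ 0≤s (0≤+ 2)) 0≤poly) (0≤-* (0≤+ 38) 0≤s))))
    λ ()
    where
    s r : ℤ
    s = + q - + 2
    r = + 2 * + k - + 3 * + q - + 3
    0≤s : 0ℤ ≤ s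
    0≤s = i≤j⇒0≤j-i (+≤+ 2≤q)
    0≤poly : 0ℤ ≤ (+ 7 * s + + 6) * (r * r) + + 26 * (s + + 2) * (s + 1ℤ) * r
                   + + 15 * s * s * s + + 68 * s * s + + 91 * s
    0≤poly =
      0≤-+ (0≤-+ (0≤-+ (0≤-+ (0≤-* (0≤-+ (0≤-* (0≤+ 7) 0≤s) (0≤+ 6)) (0≤-* 0≤r 0≤r))
                             (0≤-* (0≤-* (0≤-* (0≤+ 26) (0≤-+ 0≤s (0≤+ 2))) (0≤-+ 0≤s (0≤+ 1)))
                                   0≤r))
                       (0≤-* (0≤-* (0≤-* (0≤+ 15) 0≤s) 0≤s) 0≤s))
                 (0≤-* (0≤-* (0≤+ 68) 0≤s) 0≤s))
           (0≤-* (0≤+ 91) 0≤s)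
    certificate : ∀ K Q → let s = Q - + 2 ; r = + 2 * K - + 3 * Q - + 3 in
      + 4 * (Q * ((+ 8 * (K - + 1) * (Q * Q + K - + 2)) - (Q * (+ 7 * K * K - + 10 * K - + 1))))
      + ((s + + 2) * ((+ 7 * s + + 6) * (r * r) + + 26 * (s + + 2) * (s + 1ℤ) * r
                      + + 15 * s * s * s + + 68 * s * s + + 91 * s) + + 38 * s)
      ≡ - + 76
    certificate = solve-∀

  boundC≤boundA : ∀ {k q} → 2 ℕ.≤ k → 2 ℕ.≤ q → 0ℤ ≤ boundB k q →
                  boundC k * 1ℤ - boundA k q ≤ 0ℤ
  boundC≤boundA {k} {q} 2≤k 2≤q 0≤B =
    ≮⇒≥ λ 0<C-A → <⇒≱ (2k≥3q+3⇒B<0 {k} 2≤q (C>A⇒2k≥3q+3 {k} {q} 2≤k 0<C-A)) 0≤B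

  -- for N = q² + q + 1 lines and n = mk points: Cauchy–Schwarz over the nonsecant lines makes it
  -- nonnegative, and 4(k - 1) times it is B - (Cm - A)²
  arcQuadratic : ℤ → ℤ → ℤ → ℤ
  arcQuadratic K Q n = (+ 2 * (Q * Q + Q + 1ℤ) - n * (K - 1ℤ)) * (n + Q + + 2 - + 2 * K)
                       - + 2 * n * ((Q + + 2 - K) * (Q + + 2 - K))

  arcQuadratic⇒bound : ∀ {k q} m → 2 ℕ.≤ k → 0ℤ ≤ arcQuadratic (+ k) (+ q) (+ (m ℕ.* k)) →
    (boundC k * + m - boundA k q) * (boundC k * + m - boundA k q) ≤ boundB k q
  arcQuadratic⇒bound {k} {q} m 2≤k 0≤G = 0≤j-i⇒i≤j (subst (0ℤ ≤_) (discriminant (+ k) (+ q) (+ m))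
    (0≤-* (0≤-* (0≤+ 4) (i≤j⇒0≤j-i (+≤+ (ℕ.<⇒≤ 2≤k))))
          (subst (λ n → 0ℤ ≤ arcQuadratic (+ k) (+ q) n) (pos-* m k) 0≤G)))
    where
    discriminant : ∀ K Q M →
      + 4 * (K - 1ℤ) * ((+ 2 * (Q * Q + Q + 1ℤ) - M * K * (K - 1ℤ)) * (M * K + Q + + 2 - + 2 * K)
                        - + 2 * (M * K) * ((Q + + 2 - K) * (Q + + 2 - K)))
      ≡ Q * ((+ 8 * (K - + 1) * (Q * Q + K - + 2)) - (Q * (+ 7 * K * K - + 10 * K - + 1)))
        - (+ 2 * K * (K - + 1) * M - ((+ 4 * (K - + 1)) + ((+ 3 * K - + 5) * Q)))
        * (+ 2 * K * (K - + 1) * M - ((+ 4 * (K - + 1)) + ((+ 3 * K - + 5) * Q)))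
    discriminant = solve-∀

  n*arcQuadratic : ∀ {K Q N E S X} → + 2 * E ≡ + 2 * (Q * Q + (Q + 1ℤ)) - (N * K - N) →
                   S ≡ N * (Q + 1ℤ) - (N * K - N) → X ≡ N * N - N * K →
                   N * arcQuadratic K Q N ≡ + 2 * (E * (S + X) - S * S)
  n*arcQuadratic {K} {Q} {N} {E} {S} {X} 2E≡ S≡ X≡ = begin
    N * arcQuadratic K Q N                ≡⟨ expand K Q N ⟩
    _                                     ≡⟨ cong₂ _-_ (cong₂ _*_ 2E≡ (cong₂ _+_ S≡ X≡))
                                                       (cong (λ t → + 2 * (t * t)) S≡) ⟨
    (+ 2 * E) * (S + X) - + 2 * (S * S)   ≡⟨ double E S X ⟩
    + 2 * (E * (S + X) - S * S)           ∎
    where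
    open ≡-Reasoning
    expand : ∀ K Q N →
      N * ((+ 2 * (Q * Q + Q + 1ℤ) - N * (K - 1ℤ)) * (N + Q + + 2 - + 2 * K)
           - + 2 * N * ((Q + + 2 - K) * (Q + + 2 - K)))
      ≡ (+ 2 * (Q * Q + (Q + 1ℤ)) - (N * K - N)) * ((N * (Q + 1ℤ) - (N * K - N)) + (N * N - N * K))
        - + 2 * ((N * (Q + 1ℤ) - (N * K - N)) * (N * (Q + 1ℤ) - (N * K - N)))
    expand = solve-∀
    double : ∀ E S X → (+ 2 * E) * (S + X) - + 2 * (S * S) ≡ + 2 * (E * (S + X) - S * S)
    double = solve-∀

  a+b≡c⇒+a≡+c-+b : ∀ {a b c} → a ℕ.+ b ≡ c → + a ≡ + c - + b
  a+b≡c⇒+a≡+c-+b {a} {b} refl = sym (trans (cong (_- + b) (pos-+ a b)) (cancel (+ a) (+ b)))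
    where
    cancel : ∀ a b → a + b - b ≡ a
    cancel = solve-∀

  counts⇒arcQuadratic : ∀ {k q n E S X Z : ℕ} → 0 ℕ.< n →
    2 ℕ.* E ℕ.+ Z ≡ 2 ℕ.* (q ℕ.* q ℕ.+ (q ℕ.+ 1)) → S ℕ.+ Z ≡ n ℕ.* (q ℕ.+ 1) →
    Z ℕ.+ n ≡ n ℕ.* k → X ℕ.+ n ℕ.* k ≡ n ℕ.* n → S ℕ.* S ℕ.≤ E ℕ.* (S ℕ.+ X) →
    0ℤ ≤ arcQuadratic (+ k) (+ q) (+ n)
  counts⇒arcQuadratic {k} {q} {n} {E} {S} {X} {Z} 0<n 2E+Z≡2N S+Z≡n[q+1] Z+n≡nk X+nk≡nn S²≤E[S+X] =
    0<n⇒0≤n*i⇒0≤i (+<+ 0<n)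
      (subst (0ℤ ≤_) (sym (n*arcQuadratic {+ k} {+ q} {+ n} {+ E} {+ S} {+ X} 2E≡ S≡ X≡))
        (0≤-* (0≤+ 2) (i≤j⇒0≤j-i
          (subst₂ _≤_ (pos-* S S) (pos-* E (S ℕ.+ X)) (+≤+ S²≤E[S+X])))))
    where
    Z≡ : + Z ≡ + n * + k - + n
    Z≡ = trans (a+b≡c⇒+a≡+c-+b Z+n≡nk) (cong (_- + n) (pos-* n k))
    2E≡ : + 2 * + E ≡ + 2 * (+ q * + q + (+ q + 1ℤ)) - (+ n * + k - + n)
    2E≡ = trans (sym (pos-* 2 E)) (trans (a+b≡c⇒+a≡+c-+b 2E+Z≡2N) (cong₂ _-_
            (trans (pos-* 2 (q ℕ.* q ℕ.+ (q ℕ.+ 1))) (cong (λ t → + 2 * (t + (+ q + 1ℤ))) (pos-* q q)))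
            Z≡))
    S≡ : + S ≡ + n * (+ q + 1ℤ) - (+ n * + k - + n)
    S≡ = trans (a+b≡c⇒+a≡+c-+b S+Z≡n[q+1]) (cong₂ _-_ (pos-* n (q ℕ.+ 1)) Z≡)
    X≡ : + X ≡ + n * + n - + n * + k
    X≡ = trans (a+b≡c⇒+a≡+c-+b X+nk≡nn) (cong₂ _-_ (pos-* n n) (pos-* n k))

  0≤boundC : ∀ {k} → 2 ℕ.≤ k → 0ℤ ≤ boundC k
  0≤boundC {k} 2≤k = 0≤-* (0≤-* (0≤+ 2) (0≤+ k)) (i≤j⇒0≤j-i (+≤+ (ℕ.<⇒≤ 2≤k)))

  1≤floor : ∀ {k q f} → 2 ℕ.≤ k → 2 ℕ.≤ q → 0ℤ ≤ boundB k q →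
            IsFloorOfSqrtExpr (boundA k q) (boundB k q) (boundC k) f → 1ℤ ≤ f
  1≤floor 2≤k 2≤q 0≤B = ≤-floor 1ℤ (0≤boundC 2≤k) (inj₁ (boundC≤boundA 2≤k 2≤q 0≤B))

  arcQuadratic⇒≤floor : ∀ {k q f} m → 2 ℕ.≤ k → 0ℤ ≤ arcQuadratic (+ k) (+ q) (+ (m ℕ.* k)) →
                        IsFloorOfSqrtExpr (boundA k q) (boundB k q) (boundC k) f → + m ≤ f
  arcQuadratic⇒≤floor m 2≤k 0≤G =
    ≤-floor (+ m) (0≤boundC 2≤k) (inj₂ (arcQuadratic⇒bound m 2≤k 0≤G))

  +m≤f⇒+[m*k]≤+k*f : ∀ {m f} k → + m ≤ f → + (m ℕ.* k) ≤ + k * f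
  +m≤f⇒+[m*k]≤+k*f {m} {f} k m≤f =
    subst (_≤ + k * f) (trans (*-comm (+ k) (+ m)) (sym (pos-* m k))) (*-monoˡ-≤-nonNeg (+ k) m≤f)

open import Algebra.Bundles using (CommutativeRing)
open import Data.Nat.Base using (ℕ; _≤_)
open import Data.Fin.Base using (Fin)

module NatSum where
  open import Data.Nat.Base
  open import Data.Nat.Properties hiding (_≟_)
  open import Data.Nat.Tactic.RingSolver using (solve-∀)
  open import Data.Fin.Base using (Fin; zero; suc; _↑ˡ_; _↑ʳ_; combine)
  open import Data.Fin.Properties using (_≟_)
  open import Data.Sum.Base using (inj₁; inj₂)
  open import Function.Base using (_∘_)
  open import Relation.Binary.PropositionalEquality
  open import Relation.Nullary using (¬_; Dec; yes; no; ¬?)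
  open import Relation.Nullary.Negation using (contradiction)
  open import Algebra.Properties.Semiring.Sum +-*-semiring public
    using (sum; sum-syntax; sum-cong-≗; ∑-distrib-+; ∑-comm; *-distribˡ-sum; *-distribʳ-sum)

  𝟙 : ∀ {a} {A : Set a} → Dec A → ℕ
  𝟙 (yes _) = 1
  𝟙 (no _)  = 0

  𝟙-yes : ∀ {a} {A : Set a} (d : Dec A) → A → 𝟙 d ≡ 1
  𝟙-yes (yes _) _ = refl
  𝟙-yes (no ¬a) a = contradiction a ¬a

  𝟙-no : ∀ {a} {A : Set a} (d : Dec A) → ¬ A → 𝟙 d ≡ 0
  𝟙-no (yes a) ¬a = contradiction a ¬a
  𝟙-no (no _)  _  = refl

  𝟙*𝟙≡𝟙 : ∀ {a} {A : Set a} (d : Dec A) → 𝟙 d * 𝟙 d ≡ 𝟙 d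
  𝟙*𝟙≡𝟙 (yes _) = refl
  𝟙*𝟙≡𝟙 (no _)  = refl

  ∑-const : ∀ n c → ∑[ i < n ] c ≡ n * c
  ∑-const zero    c = refl
  ∑-const (suc n) c = cong (c +_) (∑-const n c)

  ∑-zero : ∀ {n} {f : Fin n → ℕ} → (∀ i → f i ≡ 0) → sum f ≡ 0
  ∑-zero {n} f≡0 = trans (sum-cong-≗ f≡0) (trans (∑-const n 0) (*-zeroʳ n))

  ∑-mono-≤ : ∀ {n} {f g : Fin n → ℕ} → (∀ i → f i ≤ g i) → sum f ≤ sum g
  ∑-mono-≤ {zero}  f≤g = z≤n
  ∑-mono-≤ {suc n} f≤g = +-mono-≤ (f≤g zero) (∑-mono-≤ (f≤g ∘ suc))

  ∑-*ˡ : ∀ {n} c (f : Fin n → ℕ) → ∑[ i < n ] (c * f i) ≡ c * sum f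
  ∑-*ˡ c f = sym (*-distribˡ-sum c f)

  sum*sum : ∀ {m n} (f : Fin m → ℕ) (g : Fin n → ℕ) →
            sum f * sum g ≡ ∑[ i < m ] ∑[ j < n ] (f i * g j)
  sum*sum f g = trans (*-distribʳ-sum (sum g) f) (sum-cong-≗ (λ i → *-distribˡ-sum (f i) g))

  ∑-𝟙≟ : ∀ {n} (i : Fin n) (f : Fin n → ℕ) → ∑[ j < n ] (𝟙 (i ≟ j) * f j) ≡ f i
  ∑-𝟙≟ zero    f = trans (cong₂ _+_ (*-identityˡ (f zero)) (∑-zero {f = λ j → 0 * f (suc j)} λ _ → refl))
                         (+-identityʳ (f zero))
  ∑-𝟙≟ (suc i) f = trans (sum-cong-≗ step) (∑-𝟙≟ i (f ∘ suc))
    where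
    step : ∀ j → 𝟙 (suc i ≟ suc j) * f (suc j) ≡ 𝟙 (i ≟ j) * f (suc j)
    step j with i ≟ j
    ... | yes _ = refl
    ... | no  _ = refl

  ∑-single : ∀ {n} {f : Fin n → ℕ} i → (∀ j → j ≢ i → f j ≡ 0) → sum f ≡ f i
  ∑-single {f = f} i f≡0 = trans (sum-cong-≗ delta) (∑-𝟙≟ i f)
    where
    delta : ∀ j → f j ≡ 𝟙 (i ≟ j) * f j
    delta j with i ≟ j
    ... | yes _   = sym (+-identityʳ (f j))
    ... | no  i≢j = f≡0 j (i≢j ∘ sym)

  ∑-pair : ∀ {n} {f : Fin n → ℕ} a b → a ≢ b → (∀ c → c ≢ a → c ≢ b → f c ≡ 0) →
           sum f ≡ f a + f b
  ∑-pair {n} {f} a b a≢b f≡0 = begin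
    sum f
      ≡⟨ sum-cong-≗ delta ⟩
    ∑[ c < n ] (𝟙 (a ≟ c) * f c + 𝟙 (b ≟ c) * f c)
      ≡⟨ ∑-distrib-+ (λ c → 𝟙 (a ≟ c) * f c) (λ c → 𝟙 (b ≟ c) * f c) ⟩
    ∑[ c < n ] (𝟙 (a ≟ c) * f c) + ∑[ c < n ] (𝟙 (b ≟ c) * f c)
      ≡⟨ cong₂ _+_ (∑-𝟙≟ a f) (∑-𝟙≟ b f) ⟩
    f a + f b
      ∎
    where
    open ≡-Reasoning
    delta : ∀ c → f c ≡ 𝟙 (a ≟ c) * f c + 𝟙 (b ≟ c) * f c
    delta c with a ≟ c | b ≟ c
    ... | yes refl | yes refl = contradiction refl a≢b
    ... | yes _    | no _     = sym (trans (+-identityʳ _) (+-identityʳ _))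
    ... | no _     | yes _    = sym (+-identityʳ _)
    ... | no a≢c   | no b≢c   = f≡0 c (a≢c ∘ sym) (b≢c ∘ sym)

  ∑-↑ : ∀ m {n} (f : Fin (m + n) → ℕ) →
        sum f ≡ ∑[ i < m ] f (i ↑ˡ n) + ∑[ j < n ] f (m ↑ʳ j)
  ∑-↑ zero    f = refl
  ∑-↑ (suc m) f = trans (cong (f zero +_) (∑-↑ m (f ∘ suc))) (sym (+-assoc (f zero) _ _))

  ∑-combine : ∀ m {n} (f : Fin (m * n) → ℕ) → sum f ≡ ∑[ i < m ] ∑[ j < n ] f (combine i j)
  ∑-combine zero    f = refl
  ∑-combine (suc m) {n} f =
    trans (∑-↑ n f) (cong (∑[ j < n ] f (j ↑ˡ (m * n)) +_) (∑-combine m (f ∘ (n ↑ʳ_))))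

  offDiag : ∀ {n} → (Fin n → Fin n → ℕ) → ℕ
  offDiag {n} f = ∑[ i < n ] ∑[ j < n ] (𝟙 (¬? (i ≟ j)) * f i j)

  ∑∑-diagonal+offDiag : ∀ {n} (f : Fin n → Fin n → ℕ) →
                        ∑[ i < n ] ∑[ j < n ] f i j ≡ ∑[ i < n ] f i i + offDiag f
  ∑∑-diagonal+offDiag {n} f =
    trans (sum-cong-≗ row) (∑-distrib-+ (λ i → f i i) (λ i → ∑[ j < n ] off i j))
    where
    off : Fin n → Fin n → ℕ
    off i j = 𝟙 (¬? (i ≟ j)) * f i j
    split : ∀ i j → f i j ≡ 𝟙 (i ≟ j) * f i j + off i j
    split i j with i ≟ j
    ... | yes _ = sym (trans (+-identityʳ _) (+-identityʳ _))
    ... | no  _ = sym (+-identityʳ _)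
    row : ∀ i → ∑[ j < n ] f i j ≡ f i i + ∑[ j < n ] off i j
    row i = trans (sum-cong-≗ (split i)) (trans (∑-distrib-+ (λ j → 𝟙 (i ≟ j) * f i j) (off i))
                                                (cong (_+ ∑[ j < n ] off i j) (∑-𝟙≟ i (f i))))

  offDiag-cong : ∀ {n} {f g : Fin n → Fin n → ℕ} → (∀ i j → i ≢ j → f i j ≡ g i j) →
                 offDiag f ≡ offDiag g
  offDiag-cong {f = f} {g} f≡g = sum-cong-≗ λ i → sum-cong-≗ λ j → entry i j
    where
    entry : ∀ i j → 𝟙 (¬? (i ≟ j)) * f i j ≡ 𝟙 (¬? (i ≟ j)) * g i j
    entry i j with i ≟ j
    ... | yes _   = refl
    ... | no  i≢j = cong (_+ 0) (f≡g i j i≢j)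

  offDiag-zero : ∀ {n} {f : Fin n → Fin n → ℕ} → (∀ i j → i ≢ j → f i j ≡ 0) →
                 offDiag f ≡ 0
  offDiag-zero {n} f≡0 = trans (offDiag-cong f≡0)
    (∑-zero {f = λ i → ∑[ j < n ] (𝟙 (¬? (i ≟ j)) * 0)} λ i →
       ∑-zero {f = λ j → 𝟙 (¬? (i ≟ j)) * 0} λ j → *-zeroʳ (𝟙 (¬? (i ≟ j))))

  offDiag-const : ∀ n c → offDiag {n} (λ _ _ → c) + n * c ≡ n * n * c
  offDiag-const n c = begin
    offDiag C + n * c              ≡⟨ +-comm (offDiag C) (n * c) ⟩
    n * c + offDiag C              ≡⟨ cong (_+ offDiag C) (∑-const n c) ⟨
    ∑[ i < n ] c + offDiag C       ≡⟨ ∑∑-diagonal+offDiag C ⟨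
    ∑[ i < n ] ∑[ j < n ] c        ≡⟨ trans (sum-cong-≗ {n} (λ _ → ∑-const n c)) (∑-const n (n * c)) ⟩
    n * (n * c)                    ≡⟨ *-assoc n n c ⟨
    n * n * c                      ∎
    where
    open ≡-Reasoning
    C : Fin n → Fin n → ℕ
    C _ _ = c

  ∑-offDiag : ∀ {m n} (f : Fin m → Fin n → Fin n → ℕ) →
              ∑[ l < m ] offDiag (f l) ≡ offDiag (λ i j → ∑[ l < m ] f l i j)
  ∑-offDiag {m} {n} f = begin
    ∑[ l < m ] ∑[ i < n ] ∑[ j < n ] (𝟙 (¬? (i ≟ j)) * f l i j)
      ≡⟨ ∑-comm (λ l i → ∑[ j < n ] (𝟙 (¬? (i ≟ j)) * f l i j)) ⟩
    ∑[ i < n ] ∑[ l < m ] ∑[ j < n ] (𝟙 (¬? (i ≟ j)) * f l i j)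
      ≡⟨ sum-cong-≗ (λ i → ∑-comm λ l j → 𝟙 (¬? (i ≟ j)) * f l i j) ⟩
    ∑[ i < n ] ∑[ j < n ] ∑[ l < m ] (𝟙 (¬? (i ≟ j)) * f l i j)
      ≡⟨ sum-cong-≗ (λ i → sum-cong-≗ λ j → ∑-*ˡ (𝟙 (¬? (i ≟ j))) (λ l → f l i j)) ⟩
    offDiag (λ i j → ∑[ l < m ] f l i j)
      ∎
    where open ≡-Reasoning

  private
    2xy≤x²+y²-ordered : ∀ {x y} → x ≤ y → 2 * (x * y) ≤ x * x + y * y
    2xy≤x²+y²-ordered {x} {y} x≤y = subst (λ y → 2 * (x * y) ≤ x * x + y * y) (m+[n∸m]≡n x≤y)
      (subst (2 * (x * (x + d)) ≤_) (square x d) (m≤m+n _ (d * d)))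
      where
      d : ℕ
      d = y ∸ x
      square : ∀ x d → 2 * (x * (x + d)) + d * d ≡ x * x + (x + d) * (x + d)
      square = solve-∀

    2xy≤x²+y² : ∀ x y → 2 * (x * y) ≤ x * x + y * y
    2xy≤x²+y² x y with ≤-total x y
    ... | inj₁ x≤y = 2xy≤x²+y²-ordered x≤y
    ... | inj₂ y≤x = subst₂ _≤_ (cong (2 *_) (*-comm y x)) (+-comm (y * y) (x * x))
                       (2xy≤x²+y²-ordered y≤x)

  Cauchy–Schwarz : ∀ {n} (a b : Fin n → ℕ) →
    ∑[ i < n ] (a i * b i) * ∑[ i < n ] (a i * b i) ≤ ∑[ i < n ] (a i * a i) * ∑[ i < n ] (b i * b i)
  Cauchy–Schwarz {n} a b = *-cancelˡ-≤ 2 (begin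
    2 * (AB * AB)
      ≡⟨ cong (2 *_) (sum*sum ab ab) ⟩
    2 * ∑[ i < n ] ∑[ j < n ] (ab i * ab j)
      ≡⟨ double-∑ (λ i j → ab i * ab j) ⟨
    ∑[ i < n ] ∑[ j < n ] (2 * (ab i * ab j))
      ≤⟨ ∑-mono-≤ (λ i → ∑-mono-≤ λ j → cross i j) ⟩
    ∑[ i < n ] ∑[ j < n ] (a² i * b² j + a² j * b² i)
      ≡⟨ sum-cong-≗ (λ i → ∑-distrib-+ (λ j → a² i * b² j) (λ j → a² j * b² i)) ⟩
    ∑[ i < n ] (∑[ j < n ] (a² i * b² j) + ∑[ j < n ] (a² j * b² i))
      ≡⟨ ∑-distrib-+ (λ i → ∑[ j < n ] (a² i * b² j)) (λ i → ∑[ j < n ] (a² j * b² i)) ⟩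
    ∑[ i < n ] ∑[ j < n ] (a² i * b² j) + ∑[ i < n ] ∑[ j < n ] (a² j * b² i)
      ≡⟨ cong₂ _+_ (sum*sum a² b²) (trans (sum*sum a² b²) (∑-comm λ i j → a² i * b² j)) ⟨
    A² * B² + A² * B²
      ≡⟨ cong (A² * B² +_) (+-identityʳ _) ⟨
    2 * (A² * B²)
      ∎)
    where
    open ≤-Reasoning
    ab a² b² : Fin n → ℕ
    ab i = a i * b i
    a² i = a i * a i
    b² i = b i * b i
    AB A² B² : ℕ
    AB = sum ab
    A² = sum a²
    B² = sum b²
    double-∑ : (f : Fin n → Fin n → ℕ) →
               ∑[ i < n ] ∑[ j < n ] (2 * f i j) ≡ 2 * ∑[ i < n ] ∑[ j < n ] f i j
    double-∑ f = trans (sum-cong-≗ λ i → ∑-*ˡ 2 (f i)) (∑-*ˡ 2 λ i → ∑[ j < n ] f i j)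
    rearrange : ∀ ai bi aj bj → (ai * bj) * (aj * bi) ≡ (ai * bi) * (aj * bj)
    rearrange = solve-∀
    squares : ∀ ai bi aj bj →
      (ai * bj) * (ai * bj) + (aj * bi) * (aj * bi) ≡ (ai * ai) * (bj * bj) + (aj * aj) * (bi * bi)
    squares = solve-∀
    cross : ∀ i j → 2 * (ab i * ab j) ≤ a² i * b² j + a² j * b² i
    cross i j = subst₂ _≤_ (cong (2 *_) (rearrange (a i) (b i) (a j) (b j)))
                           (squares (a i) (b i) (a j) (b j))
                           (2xy≤x²+y² (a i * b j) (a j * b i))

-- The ring solver for R with integer coefficients: equality in R is not decidable by computation,
-- so normal forms are compared in ℤ and mapped to R by the canonical homomorphism.
module IntegerCoefficients {c ℓ} (R : CommutativeRing c ℓ) where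
  open import Data.Nat.Base as ℕ using (zero; suc)
  import Data.Nat.Properties as ℕ
  open import Data.Integer.Base as ℤ using (ℤ; +_; -[1+_]; _⊖_; _◃_; sign; ∣_∣)
  import Data.Integer.Properties as ℤ
  open import Data.Sign.Base as Sign using (Sign)
  open import Data.Maybe.Base using (Maybe; just; nothing)
  open import Relation.Binary.PropositionalEquality.Core as ≡ using (_≡_)
  open import Relation.Nullary using (yes; no)
  open import Algebra.Solver.Ring.AlmostCommutativeRing

  open CommutativeRing R
  open import Algebra.Properties.Ring ring using (-‿involutive; -0#≈0#; -1*x≈-x; -‿+-comm)
  open import Algebra.Properties.Semiring.Mult.TCOptimised semiring using (_×_; ×-homo-+; ×1-homo-*; 1+×)
  open import Relation.Binary.Reasoning.Setoid setoid

  private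
    ⟦_⟧ : ℤ → Carrier
    ⟦ + n      ⟧ = n × 1#
    ⟦ -[1+ n ] ⟧ = - (suc n × 1#)

    sign⟦_⟧ : Sign → Carrier
    sign⟦ Sign.+ ⟧ = 1#
    sign⟦ Sign.- ⟧ = - 1#

    ⊖-homo : ∀ m n → ⟦ m ⊖ n ⟧ ≈ m × 1# - n × 1#
    ⊖-homo zero    zero    = sym (-‿inverseʳ 0#)
    ⊖-homo (suc m) zero    = sym (trans (+-congˡ -0#≈0#) (+-identityʳ _))
    ⊖-homo zero    (suc n) = sym (+-identityˡ _)
    ⊖-homo (suc m) (suc n) = begin
      ⟦ suc m ⊖ suc n ⟧                ≡⟨ ≡.cong ⟦_⟧ (ℤ.[1+m]⊖[1+n]≡m⊖n m n) ⟩
      ⟦ m ⊖ n ⟧                        ≈⟨ ⊖-homo m n ⟩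
      m × 1# - n × 1#                  ≈⟨ +-congʳ (+-identityˡ _) ⟨
      (0# + m × 1#) - n × 1#           ≈⟨ +-congʳ (+-congʳ (-‿inverseʳ 1#)) ⟨
      ((1# - 1#) + m × 1#) - n × 1#    ≈⟨ shuffle 1# (m × 1#) (n × 1#) ⟩
      (1# + m × 1#) - (1# + n × 1#)    ≈⟨ +-cong (1+× m 1#) (-‿cong (1+× n 1#)) ⟨
      suc m × 1# - suc n × 1#          ∎
      where
      shuffle : ∀ a b c → ((a - a) + b) - c ≈ (a + b) - (a + c)
      shuffle a b c = begin
        ((a - a) + b) - c      ≈⟨ +-congʳ (+-assoc a (- a) b) ⟩
        (a + (- a + b)) - c    ≈⟨ +-congʳ (+-congˡ (+-comm (- a) b)) ⟩
        (a + (b - a)) - c      ≈⟨ +-congʳ (+-assoc a b (- a)) ⟨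
        ((a + b) - a) - c      ≈⟨ +-assoc (a + b) (- a) (- c) ⟩
        (a + b) + (- a - c)    ≈⟨ +-congˡ (-‿+-comm a c) ⟩
        (a + b) - (a + c)      ∎

    +-homo : ∀ i j → ⟦ i ℤ.+ j ⟧ ≈ ⟦ i ⟧ + ⟦ j ⟧
    +-homo (+ m)      (+ n)      = ×-homo-+ 1# m n
    +-homo (+ m)      -[1+ n ]   = ⊖-homo m (suc n)
    +-homo -[1+ m ]   (+ n)      = trans (⊖-homo n (suc m)) (+-comm _ _)
    +-homo -[1+ m ]   -[1+ n ]   = begin
      - (suc (suc (m ℕ.+ n)) × 1#)           ≡⟨ ≡.cong (λ k → - (suc k × 1#)) (ℕ.+-suc m n) ⟨
      - ((suc m ℕ.+ suc n) × 1#)             ≈⟨ -‿cong (×-homo-+ 1# (suc m) (suc n)) ⟩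
      - (suc m × 1# + suc n × 1#)            ≈⟨ -‿+-comm _ _ ⟨
      - (suc m × 1#) + - (suc n × 1#)        ∎

    ◃-homo : ∀ s n → ⟦ s ◃ n ⟧ ≈ sign⟦ s ⟧ * (n × 1#)
    ◃-homo Sign.+ zero    = sym (zeroʳ _)
    ◃-homo Sign.- zero    = sym (zeroʳ _)
    ◃-homo Sign.+ (suc n) = sym (*-identityˡ _)
    ◃-homo Sign.- (suc n) = sym (-1*x≈-x _)

    sign-homo : ∀ s t → sign⟦ s Sign.* t ⟧ ≈ sign⟦ s ⟧ * sign⟦ t ⟧
    sign-homo Sign.+ t      = sym (*-identityˡ _)
    sign-homo Sign.- Sign.+ = sym (*-identityʳ _)
    sign-homo Sign.- Sign.- = sym (trans (-1*x≈-x _) (-‿involutive _))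

    sign-abs : ∀ i → ⟦ i ⟧ ≈ sign⟦ sign i ⟧ * (∣ i ∣ × 1#)
    sign-abs i = trans (reflexive (≡.cong ⟦_⟧ (≡.sym (ℤ.◃-inverse i)))) (◃-homo (sign i) ∣ i ∣)

    *-homo : ∀ i j → ⟦ i ℤ.* j ⟧ ≈ ⟦ i ⟧ * ⟦ j ⟧
    *-homo i j = begin
      ⟦ (sign i Sign.* sign j) ◃ (∣ i ∣ ℕ.* ∣ j ∣) ⟧
        ≈⟨ ◃-homo _ (∣ i ∣ ℕ.* ∣ j ∣) ⟩
      sign⟦ sign i Sign.* sign j ⟧ * ((∣ i ∣ ℕ.* ∣ j ∣) × 1#)
        ≈⟨ *-cong (sign-homo (sign i) (sign j)) (×1-homo-* ∣ i ∣ ∣ j ∣) ⟩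
      (sign⟦ sign i ⟧ * sign⟦ sign j ⟧) * ((∣ i ∣ × 1#) * (∣ j ∣ × 1#))
        ≈⟨ interchange _ _ _ _ ⟩
      (sign⟦ sign i ⟧ * (∣ i ∣ × 1#)) * (sign⟦ sign j ⟧ * (∣ j ∣ × 1#))
        ≈⟨ *-cong (sign-abs i) (sign-abs j) ⟨
      ⟦ i ⟧ * ⟦ j ⟧
        ∎
      where
      interchange : ∀ a b c d → (a * b) * (c * d) ≈ (a * c) * (b * d)
      interchange a b c d = begin
        (a * b) * (c * d)   ≈⟨ *-assoc a b (c * d) ⟩
        a * (b * (c * d))   ≈⟨ *-congˡ (*-assoc b c d) ⟨
        a * ((b * c) * d)   ≈⟨ *-congˡ (*-congʳ (*-comm b c)) ⟩
        a * ((c * b) * d)   ≈⟨ *-congˡ (*-assoc c b d) ⟩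
        a * (c * (b * d))   ≈⟨ *-assoc a c (b * d) ⟨
        (a * c) * (b * d)   ∎

    -‿homo : ∀ i → ⟦ ℤ.- i ⟧ ≈ - ⟦ i ⟧
    -‿homo (+ zero)  = sym -0#≈0#
    -‿homo (+ suc n) = refl
    -‿homo -[1+ n ]  = sym (-‿involutive _)

    homomorphism : ℤ.+-*-rawRing -Raw-AlmostCommutative⟶ fromCommutativeRing R
    homomorphism = record
      { ⟦_⟧    = ⟦_⟧
      ; +-homo = +-homo
      ; *-homo = *-homo
      ; -‿homo = -‿homo
      ; 0-homo = refl
      ; 1-homo = refl
      }

    ⟦⟧-≟ : ∀ i j → Maybe (⟦ i ⟧ ≈ ⟦ j ⟧)
    ⟦⟧-≟ i j with i ℤ.≟ j
    ... | yes ≡.refl = just refl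
    ... | no  _      = nothing

  open import Algebra.Solver.Ring ℤ.+-*-rawRing (fromCommutativeRing R) homomorphism ⟦⟧-≟ public

module ProjectivePlane {q : ℕ} (F : FiniteField q) where
  open import Data.Nat.Base as ℕ using (ℕ; zero; suc; s≤s; z≤n)
  import Data.Nat.Properties as ℕ
  open import Data.Fin.Base as Fin using (Fin; zero; suc; _↑ˡ_; _↑ʳ_; combine; splitAt; remQuot)
  import Data.Fin.Properties as Fin
  open import Data.Product.Base using (Σ; _×_; _,_; proj₁; proj₂; uncurry)
  open import Data.Sum.Base using (_⊎_; inj₁; inj₂; [_,_]′)
  open import Data.Integer.Base using (+_)
  open import Function.Base using (_∘_)
  open import Relation.Binary.PropositionalEquality as ≡ using (_≡_; _≢_)
  open import Relation.Nullary using (¬_; Dec; yes; no)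
  open import Relation.Nullary.Negation using (contradiction)
  import Relation.Binary.Reasoning.Setoid

  open FiniteField F hiding (zero)
  open import Algebra.Properties.Ring ring using (+-cancelʳ)
  open PG2 F
  open NatSum
  open IntegerCoefficients commRing using (solve; _:=_; _:+_; _:*_; _:-_; con; Polynomial)
  module ≈-Reasoning = Relation.Binary.Reasoning.Setoid setoid

  _≈?_ : ∀ x y → Dec (x ≈ y)
  x ≈? y with enum-sur x | enum-sur y
  ... | i , i↦x | j , j↦y with i Fin.≟ j
  ... | yes ≡.refl = yes (trans (sym i↦x) j↦y)
  ... | no  i≢j    = no λ x≈y → i≢j (enum-inj i j (trans i↦x (trans x≈y (sym j↦y))))

  2≤q : 2 ℕ.≤ q
  2≤q = two-values enum (proj₂ (enum-sur 0#)) (proj₂ (enum-sur 1#))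
    where
    two-values : ∀ {n} (e : Fin n → Carrier) {i j} → e i ≈ 0# → e j ≈ 1# → 2 ℕ.≤ n
    two-values {suc zero}    e {zero} {zero} i↦0 j↦1 = contradiction (trans (sym j↦1) i↦0) 1≉0
    two-values {suc (suc n)} e _ _ = s≤s (s≤s z≤n)

  *-cancelˡ : ∀ {c a b} → ¬ c ≈ 0# → c * a ≈ c * b → a ≈ b
  *-cancelˡ {c} {a} {b} c≉0 ca≈cb with inverse c c≉0
  ... | c⁻¹ , cc⁻¹≈1 = begin
    a                ≈⟨ *-identityˡ a ⟨
    1# * a           ≈⟨ *-congʳ (trans (*-comm c⁻¹ c) cc⁻¹≈1) ⟨
    (c⁻¹ * c) * a    ≈⟨ *-assoc c⁻¹ c a ⟩
    c⁻¹ * (c * a)    ≈⟨ *-congˡ ca≈cb ⟩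
    c⁻¹ * (c * b)    ≈⟨ *-assoc c⁻¹ c b ⟨
    (c⁻¹ * c) * b    ≈⟨ *-congʳ (trans (*-comm c⁻¹ c) cc⁻¹≈1) ⟩
    1# * b           ≈⟨ *-identityˡ b ⟩
    b                ∎
    where open ≈-Reasoning

  isZero : Carrier → ℕ
  isZero x = 𝟙 (x ≈? 0#)

  isZero-cong : ∀ {x y} → x ≈ y → isZero x ≡ isZero y
  isZero-cong {x} {y} x≈y with x ≈? 0# | y ≈? 0#
  ... | yes _   | yes _   = ≡.refl
  ... | no  _   | no  _   = ≡.refl
  ... | yes x≈0 | no  y≉0 = contradiction (trans (sym x≈y) x≈0) y≉0
  ... | no  x≉0 | yes y≈0 = contradiction (trans x≈y y≈0) x≉0

  roots : Carrier → Carrier → ℕ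
  roots c d = ∑[ i < q ] isZero (c * enum i + d)

  roots-unique : ∀ {c} d → ¬ c ≈ 0# → roots c d ≡ 1
  roots-unique {c} d c≉0 with inverse c c≉0
  ... | c⁻¹ , cc⁻¹≈1 with enum-sur (c⁻¹ * - d)
  ... | i₀ , i₀↦root = ≡.trans (∑-single i₀ other-nonroot) (𝟙-yes (_ ≈? 0#) i₀-root)
    where
    root : c * (c⁻¹ * - d) + d ≈ 0#
    root = begin
      c * (c⁻¹ * - d) + d    ≈⟨ +-congʳ (*-assoc c c⁻¹ (- d)) ⟨
      (c * c⁻¹) * - d + d    ≈⟨ +-congʳ (*-congʳ cc⁻¹≈1) ⟩
      1# * - d + d           ≈⟨ +-congʳ (*-identityˡ (- d)) ⟩
      - d + d                ≈⟨ -‿inverseˡ d ⟩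
      0#                     ∎
      where open ≈-Reasoning
    i₀-root : c * enum i₀ + d ≈ 0#
    i₀-root = trans (+-congʳ (*-congˡ i₀↦root)) root
    other-nonroot : ∀ i → i ≢ i₀ → isZero (c * enum i + d) ≡ 0
    other-nonroot i i≢i₀ = 𝟙-no (_ ≈? 0#) λ i-root → i≢i₀ (enum-inj i i₀
      (*-cancelˡ c≉0 (+-cancelʳ d _ _ (trans i-root (sym i₀-root)))))

  roots-none : ∀ {c d} → c ≈ 0# → ¬ d ≈ 0# → roots c d ≡ 0
  roots-none {c} {d} c≈0 d≉0 = ∑-zero λ i → 𝟙-no (_ ≈? 0#) λ root → d≉0 (begin
    d                 ≈⟨ +-identityˡ d ⟨
    0# + d            ≈⟨ +-congʳ (trans (*-congʳ c≈0) (zeroˡ (enum i))) ⟨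
    c * enum i + d    ≈⟨ root ⟩
    0#                ∎)
    where open ≈-Reasoning

  roots-all : ∀ {c d} → c ≈ 0# → d ≈ 0# → roots c d ≡ q
  roots-all {c} {d} c≈0 d≈0 = ≡.trans (sum-cong-≗ λ i → 𝟙-yes (_ ≈? 0#) (begin
    c * enum i + d    ≈⟨ +-cong (trans (*-congʳ c≈0) (zeroˡ (enum i))) d≈0 ⟩
    0# + 0#           ≈⟨ +-identityʳ 0# ⟩
    0#                ∎)) (≡.trans (∑-const q 1) (ℕ.*-identityʳ q))
    where open ≈-Reasoning

  dot : Vec3 → Vec3 → Carrier
  dot (a , b , c) (x , y , z) = a * x + b * y + c * z

  -- lines in normal form: the first nonzero coordinate is 1
  data Line : Set where
    ⟨1,_,_⟩ : Fin q → Fin q → Line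
    ⟨0,1,_⟩ : Fin q → Line
    ⟨0,0,1⟩ : Line

  coordsₗ : Line → Vec3
  coordsₗ ⟨1, a , b ⟩ = 1# , enum a , enum b
  coordsₗ ⟨0,1, a ⟩   = 0# , 1# , enum a
  coordsₗ ⟨0,0,1⟩     = 0# , 0# , 1#

  infix 4 _∋_ _∋?_
  _∋_ : Line → Point → Set
  L ∋ P = dot (coordsₗ L) (coords P) ≈ 0#

  _∋?_ : ∀ L P → Dec (L ∋ P)
  L ∋? P = dot (coordsₗ L) (coords P) ≈? 0#

  χ : Line → Point → ℕ
  χ L P = 𝟙 (L ∋? P)

  lineCount : ℕ
  lineCount = q ℕ.* q ℕ.+ (q ℕ.+ 1)

  index : Line → Fin lineCount
  index ⟨1, a , b ⟩ = combine a b ↑ˡ (q ℕ.+ 1)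
  index ⟨0,1, a ⟩   = (q ℕ.* q) ↑ʳ (a ↑ˡ 1)
  index ⟨0,0,1⟩     = (q ℕ.* q) ↑ʳ (q ↑ʳ zero)

  lineOfBlock : Fin (q ℕ.* q) ⊎ Fin (q ℕ.+ 1) → Line
  lineOfBlock = [ uncurry ⟨1,_,_⟩ ∘ remQuot q , [ ⟨0,1,_⟩ , (λ _ → ⟨0,0,1⟩) ]′ ∘ splitAt q ]′

  line : Fin lineCount → Line
  line = lineOfBlock ∘ splitAt (q ℕ.* q)

  line-index : ∀ L → line (index L) ≡ L
  line-index ⟨1, a , b ⟩ rewrite Fin.splitAt-↑ˡ (q ℕ.* q) (combine a b) (q ℕ.+ 1) =
    ≡.cong (uncurry ⟨1,_,_⟩) (Fin.remQuot-combine a b)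
  line-index ⟨0,1, a ⟩   rewrite Fin.splitAt-↑ʳ (q ℕ.* q) (q ℕ.+ 1) (a ↑ˡ 1)
                                | Fin.splitAt-↑ˡ q a 1 = ≡.refl
  line-index ⟨0,0,1⟩     rewrite Fin.splitAt-↑ʳ (q ℕ.* q) (q ℕ.+ 1) (q ↑ʳ zero)
                                | Fin.splitAt-↑ʳ q 1 zero = ≡.refl

  index-line : ∀ i → index (line i) ≡ i
  index-line i = ≡.trans (index-join (splitAt (q ℕ.* q) i)) (Fin.join-splitAt (q ℕ.* q) (q ℕ.+ 1) i)
    where
    index-join : ∀ s → index (lineOfBlock s) ≡ Fin.join (q ℕ.* q) (q ℕ.+ 1) s
    index-join (inj₁ j) = ≡.cong (_↑ˡ (q ℕ.+ 1)) (Fin.combine-remQuot {q} q j)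
    index-join (inj₂ j) =
      ≡.trans (lower (splitAt q j)) (≡.cong ((q ℕ.* q) ↑ʳ_) (Fin.join-splitAt q 1 j))
      where
      lower : ∀ s → index ([ ⟨0,1,_⟩ , (λ _ → ⟨0,0,1⟩) ]′ s) ≡ (q ℕ.* q) ↑ʳ Fin.join q 1 s
      lower (inj₁ a)    = ≡.refl
      lower (inj₂ zero) = ≡.refl

  Σₗ : (Line → ℕ) → ℕ
  Σₗ g = ∑[ i < lineCount ] g (line i)

  Σₗ-expand : ∀ g →
    Σₗ g ≡ ∑[ a < q ] ∑[ b < q ] g ⟨1, a , b ⟩ ℕ.+ (∑[ a < q ] g ⟨0,1, a ⟩ ℕ.+ (g ⟨0,0,1⟩ ℕ.+ 0))
  Σₗ-expand g = begin
    Σₗ g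
      ≡⟨ ∑-↑ (q ℕ.* q) (g ∘ line) ⟩
    ∑[ i < q ℕ.* q ] g (line (i ↑ˡ (q ℕ.+ 1))) ℕ.+ ∑[ j < q ℕ.+ 1 ] g (line ((q ℕ.* q) ↑ʳ j))
      ≡⟨ ≡.cong₂ ℕ._+_ (∑-combine q (λ i → g (line (i ↑ˡ (q ℕ.+ 1)))))
                       (∑-↑ q (λ j → g (line ((q ℕ.* q) ↑ʳ j)))) ⟩
    ∑[ a < q ] ∑[ b < q ] g (line (index ⟨1, a , b ⟩))
      ℕ.+ (∑[ a < q ] g (line (index ⟨0,1, a ⟩)) ℕ.+ (g (line (index ⟨0,0,1⟩)) ℕ.+ 0))
      ≡⟨ ≡.cong₂ ℕ._+_ (sum-cong-≗ λ a → sum-cong-≗ λ b → on-line ⟨1, a , b ⟩)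
                       (≡.cong₂ ℕ._+_ (sum-cong-≗ λ a → on-line ⟨0,1, a ⟩)
                                      (≡.cong (ℕ._+ 0) (on-line ⟨0,0,1⟩))) ⟩
    ∑[ a < q ] ∑[ b < q ] g ⟨1, a , b ⟩ ℕ.+ (∑[ a < q ] g ⟨0,1, a ⟩ ℕ.+ (g ⟨0,0,1⟩ ℕ.+ 0))
      ∎
    where
    open ≡.≡-Reasoning
    on-line : ∀ L → g (line (index L)) ≡ g L
    on-line L = ≡.cong g (line-index L)

  Σₗ-single : ∀ {g} L → (∀ L′ → L′ ≢ L → g L′ ≡ 0) → Σₗ g ≡ g L
  Σₗ-single {g} L g≡0 = ≡.trans (∑-single (index L) vanish) (≡.cong g (line-index L))
    where
    vanish : ∀ i → i ≢ index L → g (line i) ≡ 0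
    vanish i i≢L = g≡0 (line i) λ i↦L → i≢L (≡.trans (≡.sym (index-line i)) (≡.cong index i↦L))

  module _ (x y z : Carrier) where
    affine-lines-by-b : ∑[ a < q ] ∑[ b < q ] isZero (1# * x + enum a * y + enum b * z)
                        ≡ ∑[ a < q ] roots z (x + enum a * y)
    affine-lines-by-b = sum-cong-≗ λ a → sum-cong-≗ λ b → isZero-cong (solve 5 (λ x y z a b →
      con (+ 1) :* x :+ a :* y :+ b :* z := z :* b :+ (x :+ a :* y)) refl x y z (enum a) (enum b))

    affine-lines-by-a : ∑[ a < q ] ∑[ b < q ] isZero (1# * x + enum a * y + enum b * z)
                        ≡ ∑[ b < q ] roots y (x + enum b * z)
    affine-lines-by-a = ≡.trans (∑-comm λ a b → isZero (1# * x + enum a * y + enum b * z))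
      (sum-cong-≗ λ b → sum-cong-≗ λ a → isZero-cong (solve 5 (λ x y z a b →
        con (+ 1) :* x :+ a :* y :+ b :* z := y :* a :+ (x :+ b :* z)) refl x y z (enum a) (enum b)))

    vertical-lines : ∑[ a < q ] isZero (0# * x + 1# * y + enum a * z) ≡ roots z y
    vertical-lines = sum-cong-≗ λ a → isZero-cong (solve 4 (λ x y z a →
      con (+ 0) :* x :+ con (+ 1) :* y :+ a :* z := z :* a :+ y) refl x y z (enum a))

    line-at-infinity : isZero (0# * x + 0# * y + 1# * z) ≡ isZero z
    line-at-infinity = isZero-cong (solve 3 (λ x y z →
      con (+ 0) :* x :+ con (+ 0) :* y :+ con (+ 1) :* z := z) refl x y z)

  lines-through-point : ∀ P → Σₗ (λ L → χ L P) ≡ q ℕ.+ 1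
  lines-through-point (pt (x , y , z) nonzero) =
    ≡.trans (Σₗ-expand (λ L → χ L (pt (x , y , z) nonzero))) (count (z ≈? 0#) (y ≈? 0#))
    where
    count : Dec (z ≈ 0#) → Dec (y ≈ 0#) →
      ∑[ a < q ] ∑[ b < q ] isZero (1# * x + enum a * y + enum b * z)
        ℕ.+ (∑[ a < q ] isZero (0# * x + 1# * y + enum a * z) ℕ.+ (isZero (0# * x + 0# * y + 1# * z) ℕ.+ 0))
      ≡ q ℕ.+ 1
    count (no z≉0) _ = ≡.cong₂ ℕ._+_
      (≡.trans (affine-lines-by-b x y z) (≡.trans (sum-cong-≗ {q} λ a → roots-unique _ z≉0)
                                                  (≡.trans (∑-const q 1) (ℕ.*-identityʳ q))))
      (≡.cong₂ ℕ._+_ (≡.trans (vertical-lines x y z) (roots-unique y z≉0))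
                     (≡.cong (ℕ._+ 0) (≡.trans (line-at-infinity x y z) (𝟙-no (z ≈? 0#) z≉0))))
    count (yes z≈0) (no y≉0) = ≡.cong₂ ℕ._+_
      (≡.trans (affine-lines-by-a x y z) (≡.trans (sum-cong-≗ {q} λ b → roots-unique _ y≉0)
                                                  (≡.trans (∑-const q 1) (ℕ.*-identityʳ q))))
      (≡.cong₂ ℕ._+_ (≡.trans (vertical-lines x y z) (roots-none z≈0 y≉0))
                     (≡.cong (ℕ._+ 0) (≡.trans (line-at-infinity x y z) (𝟙-yes (z ≈? 0#) z≈0))))
    count (yes z≈0) (yes y≈0) = ≡.cong₂ ℕ._+_
      (≡.trans (affine-lines-by-b x y z) (∑-zero λ a → roots-none z≈0 (x+ay≉0 a)))
      (≡.cong₂ ℕ._+_ (≡.trans (vertical-lines x y z) (roots-all z≈0 y≈0))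
                     (≡.cong (ℕ._+ 0) (≡.trans (line-at-infinity x y z) (𝟙-yes (z ≈? 0#) z≈0))))
      where
      x+ay≉0 : ∀ a → ¬ x + enum a * y ≈ 0#
      x+ay≉0 a x+ay≈0 = nonzero (trans (sym x+ay≈x) x+ay≈0 , y≈0 , z≈0)
        where
        x+ay≈x : x + enum a * y ≈ x
        x+ay≈x = trans (+-congˡ (trans (*-congˡ y≈0) (zeroʳ (enum a)))) (+-identityʳ x)

  det3-dot : ∀ P Q R u X →
    det3 P Q R * dot u X ≈ (dot u P * det3 X Q R + dot u Q * det3 P X R) + dot u R * det3 P Q X
  det3-dot (p₁ , p₂ , p₃) (q₁ , q₂ , q₃) (r₁ , r₂ , r₃) (u₁ , u₂ , u₃) (x₁ , x₂ , x₃) =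
    solve 15 (λ p₁ p₂ p₃ q₁ q₂ q₃ r₁ r₂ r₃ u₁ u₂ u₃ x₁ x₂ x₃ →
      det p₁ p₂ p₃ q₁ q₂ q₃ r₁ r₂ r₃ :* dot′ u₁ u₂ u₃ x₁ x₂ x₃ :=
        (dot′ u₁ u₂ u₃ p₁ p₂ p₃ :* det x₁ x₂ x₃ q₁ q₂ q₃ r₁ r₂ r₃
         :+ dot′ u₁ u₂ u₃ q₁ q₂ q₃ :* det p₁ p₂ p₃ x₁ x₂ x₃ r₁ r₂ r₃)
        :+ dot′ u₁ u₂ u₃ r₁ r₂ r₃ :* det p₁ p₂ p₃ q₁ q₂ q₃ x₁ x₂ x₃)
      refl p₁ p₂ p₃ q₁ q₂ q₃ r₁ r₂ r₃ u₁ u₂ u₃ x₁ x₂ x₃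
    where
    det : ∀ {n} → (a₁ a₂ a₃ b₁ b₂ b₃ c₁ c₂ c₃ : Polynomial n) → Polynomial n
    det a₁ a₂ a₃ b₁ b₂ b₃ c₁ c₂ c₃ =
      ((a₁ :* ((b₂ :* c₃) :- (b₃ :* c₂))) :- (a₂ :* ((b₁ :* c₃) :- (b₃ :* c₁))))
        :+ (a₃ :* ((b₁ :* c₂) :- (b₂ :* c₁)))
    dot′ : ∀ {n} → (a b c x y z : Polynomial n) → Polynomial n
    dot′ a b c x y z = a :* x :+ b :* y :+ c :* z

  e₁ e₂ e₃ : Vec3
  e₁ = 1# , 0# , 0#
  e₂ = 0# , 1# , 0#
  e₃ = 0# , 0# , 1#

  dot-unit : ∀ a b c → (dot (a , b , c) e₁ ≈ a) × (dot (a , b , c) e₂ ≈ b) × (dot (a , b , c) e₃ ≈ c)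
  dot-unit a b c =
      solve 3 (λ a b c → a :* con (+ 1) :+ b :* con (+ 0) :+ c :* con (+ 0) := a) refl a b c
    , solve 3 (λ a b c → a :* con (+ 0) :+ b :* con (+ 1) :+ c :* con (+ 0) := b) refl a b c
    , solve 3 (λ a b c → a :* con (+ 0) :+ b :* con (+ 0) :+ c :* con (+ 1) := c) refl a b c

  unit-vector : ∀ L → Σ Vec3 λ X → dot (coordsₗ L) X ≈ 1#
  unit-vector ⟨1, a , b ⟩ = e₁ , proj₁ (dot-unit 1# (enum a) (enum b))
  unit-vector ⟨0,1, a ⟩   = e₂ , proj₁ (proj₂ (dot-unit 0# 1# (enum a)))
  unit-vector ⟨0,0,1⟩     = e₃ , proj₂ (proj₂ (dot-unit 0# 0# 1#))

  ≈0-by-unit-vector : ∀ L {d} → (∀ X → d * dot (coordsₗ L) X ≈ 0#) → d ≈ 0#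
  ≈0-by-unit-vector L {d} d*ℓX≈0 with unit-vector L
  ... | X , ℓX≈1 = trans (sym (*-identityʳ d)) (trans (*-congˡ (sym ℓX≈1)) (d*ℓX≈0 X))

  det3-through : ∀ {L P Q} R → L ∋ P → L ∋ Q → ∀ X →
    det3 (coords P) (coords Q) (coords R) * dot (coordsₗ L) X
      ≈ dot (coordsₗ L) (coords R) * det3 (coords P) (coords Q) X
  det3-through {L} {P} {Q} R L∋P L∋Q X = begin
    det3 p₀ q₀ r₀ * dot ℓ X
      ≈⟨ det3-dot p₀ q₀ r₀ ℓ X ⟩
    (dot ℓ p₀ * det3 X q₀ r₀ + dot ℓ q₀ * det3 p₀ X r₀) + dot ℓ r₀ * det3 p₀ q₀ X
      ≈⟨ +-congʳ (+-cong (trans (*-congʳ L∋P) (zeroˡ _)) (trans (*-congʳ L∋Q) (zeroˡ _))) ⟩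
    (0# + 0#) + dot ℓ r₀ * det3 p₀ q₀ X
      ≈⟨ trans (+-congʳ (+-identityʳ 0#)) (+-identityˡ _) ⟩
    dot ℓ r₀ * det3 p₀ q₀ X
      ∎
    where
    open ≈-Reasoning
    p₀ q₀ r₀ ℓ : Vec3
    p₀ = coords P
    q₀ = coords Q
    r₀ = coords R
    ℓ = coordsₗ L

  ∋-collinear : ∀ {L P Q R} → L ∋ P → L ∋ Q → L ∋ R → Collinear P Q R
  ∋-collinear {L} {P} {Q} {R} L∋P L∋Q L∋R = ≈0-by-unit-vector L λ X →
    trans (det3-through {L} {P} {Q} R L∋P L∋Q X) (trans (*-congʳ L∋R) (zeroˡ _))

  proportional⇒≡ : ∀ {L L′ α β} → ¬ α ≈ 0# → ¬ β ≈ 0# →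
                   (∀ X → dot (coordsₗ L) X * α ≈ dot (coordsₗ L′) X * β) → L ≡ L′
  proportional⇒≡ {L} {L′} {α} {β} α≉0 β≉0 ℓα≈ℓ′β =
    compare L L′ (componentwise (coordsₗ L) (coordsₗ L′) ℓα≈ℓ′β)
    where
    componentwise : ∀ u v → (∀ X → dot u X * α ≈ dot v X * β) →
      let (u₁ , u₂ , u₃) = u ; (v₁ , v₂ , v₃) = v in
      (u₁ * α ≈ v₁ * β) × (u₂ * α ≈ v₂ * β) × (u₃ * α ≈ v₃ * β)
    componentwise (u₁ , u₂ , u₃) (v₁ , v₂ , v₃) uα≈vβ =
        at e₁ (proj₁ (dot-unit u₁ u₂ u₃)) (proj₁ (dot-unit v₁ v₂ v₃))
      , at e₂ (proj₁ (proj₂ (dot-unit u₁ u₂ u₃))) (proj₁ (proj₂ (dot-unit v₁ v₂ v₃)))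
      , at e₃ (proj₂ (proj₂ (dot-unit u₁ u₂ u₃))) (proj₂ (proj₂ (dot-unit v₁ v₂ v₃)))
      where
      at : ∀ X {uᵢ vᵢ} → dot (u₁ , u₂ , u₃) X ≈ uᵢ → dot (v₁ , v₂ , v₃) X ≈ vᵢ → uᵢ * α ≈ vᵢ * β
      at X uX≈uᵢ vX≈vᵢ = trans (*-congʳ (sym uX≈uᵢ)) (trans (uα≈vβ X) (*-congʳ vX≈vᵢ))
    1≉0-scaled : ¬ 1# * α ≈ 0# * β
    1≉0-scaled 1α≈0β = α≉0 (trans (sym (*-identityˡ α)) (trans 1α≈0β (zeroˡ β)))
    0≉1-scaled : ¬ 0# * α ≈ 1# * β
    0≉1-scaled 0α≈1β = β≉0 (trans (sym (*-identityˡ β)) (trans (sym 0α≈1β) (zeroˡ α)))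
    α≈β : 1# * α ≈ 1# * β → α ≈ β
    α≈β 1α≈1β = trans (sym (*-identityˡ α)) (trans 1α≈1β (*-identityˡ β))
    same : ∀ {a a′} → α ≈ β → enum a * α ≈ enum a′ * β → a ≡ a′
    same {a} {a′} α≈β aα≈a′β = enum-inj a a′ (*-cancelˡ α≉0
      (trans (*-comm α (enum a)) (trans aα≈a′β (trans (*-congˡ (sym α≈β)) (*-comm (enum a′) α)))))
    compare : ∀ L L′ → let (u₁ , u₂ , u₃) = coordsₗ L ; (v₁ , v₂ , v₃) = coordsₗ L′ in
      (u₁ * α ≈ v₁ * β) × (u₂ * α ≈ v₂ * β) × (u₃ * α ≈ v₃ * β) → L ≡ L′
    compare ⟨1, a , b ⟩ ⟨1, a′ , b′ ⟩ (c₁ , c₂ , c₃) =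
      ≡.cong₂ ⟨1,_,_⟩ (same (α≈β c₁) c₂) (same (α≈β c₁) c₃)
    compare ⟨1, _ , _ ⟩ ⟨0,1, _ ⟩     (c₁ , _ , _)   = contradiction c₁ 1≉0-scaled
    compare ⟨1, _ , _ ⟩ ⟨0,0,1⟩       (c₁ , _ , _)   = contradiction c₁ 1≉0-scaled
    compare ⟨0,1, _ ⟩   ⟨1, _ , _ ⟩   (c₁ , _ , _)   = contradiction c₁ 0≉1-scaled
    compare ⟨0,1, a ⟩   ⟨0,1, a′ ⟩    (_ , c₂ , c₃)  = ≡.cong ⟨0,1,_⟩ (same (α≈β c₂) c₃)
    compare ⟨0,1, _ ⟩   ⟨0,0,1⟩       (_ , c₂ , _)   = contradiction c₂ 1≉0-scaled
    compare ⟨0,0,1⟩     ⟨1, _ , _ ⟩   (c₁ , _ , _)   = contradiction c₁ 0≉1-scaled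
    compare ⟨0,0,1⟩     ⟨0,1, _ ⟩     (_ , c₂ , _)   = contradiction c₂ 0≉1-scaled
    compare ⟨0,0,1⟩     ⟨0,0,1⟩       _              = ≡.refl

  -- by det3-through, both dot ℓ and dot ℓ′ are proportional to X ↦ det3 P Q X
  line-unique : ∀ {L L′ P Q R} → ¬ Collinear P Q R →
                L ∋ P → L ∋ Q → L′ ∋ P → L′ ∋ Q → L ≡ L′
  line-unique {L} {L′} {P} {Q} {R} PQR≉0 L∋P L∋Q L′∋P L′∋Q =
    proportional⇒≡ (R∉ L′ L′∋P L′∋Q) (R∉ L L∋P L∋Q) λ X → *-cancelˡ PQR≉0 (begin
      d * (dot ℓ X * dot ℓ′ r₀)           ≈⟨ *-assoc d _ _ ⟨
      (d * dot ℓ X) * dot ℓ′ r₀           ≈⟨ *-congʳ (det3-through {L} {P} {Q} R L∋P L∋Q X) ⟩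
      (dot ℓ r₀ * D X) * dot ℓ′ r₀        ≈⟨ swap (dot ℓ r₀) (D X) (dot ℓ′ r₀) ⟩
      (dot ℓ′ r₀ * D X) * dot ℓ r₀        ≈⟨ *-congʳ (det3-through {L′} {P} {Q} R L′∋P L′∋Q X) ⟨
      (d * dot ℓ′ X) * dot ℓ r₀           ≈⟨ *-assoc d _ _ ⟩
      d * (dot ℓ′ X * dot ℓ r₀)           ∎)
    where
    open ≈-Reasoning
    r₀ ℓ ℓ′ : Vec3
    r₀ = coords R
    ℓ = coordsₗ L
    ℓ′ = coordsₗ L′
    d : Carrier
    d = det3 (coords P) (coords Q) r₀
    D : Vec3 → Carrier
    D = det3 (coords P) (coords Q)
    R∉ : ∀ M → M ∋ P → M ∋ Q → ¬ dot (coordsₗ M) r₀ ≈ 0#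
    R∉ M M∋P M∋Q M∋R = PQR≉0 (∋-collinear {M} {P} {Q} {R} M∋P M∋Q M∋R)
    swap : ∀ a b c → (a * b) * c ≈ (c * b) * a
    swap = solve 3 (λ a b c → (a :* b) :* c := (c :* b) :* a) refl

  cross : Vec3 → Vec3 → Vec3
  cross (p₁ , p₂ , p₃) (q₁ , q₂ , q₃) = p₂ * q₃ - p₃ * q₂ , p₃ * q₁ - p₁ * q₃ , p₁ * q₂ - p₂ * q₁

  det3≈dot-cross : ∀ P Q X → det3 P Q X ≈ dot (cross P Q) X
  det3≈dot-cross (p₁ , p₂ , p₃) (q₁ , q₂ , q₃) (x₁ , x₂ , x₃) =
    solve 9 (λ p₁ p₂ p₃ q₁ q₂ q₃ x₁ x₂ x₃ →
        ((p₁ :* ((q₂ :* x₃) :- (q₃ :* x₂))) :- (p₂ :* ((q₁ :* x₃) :- (q₃ :* x₁))))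
          :+ (p₃ :* ((q₁ :* x₂) :- (q₂ :* x₁)))
      := (p₂ :* q₃ :- p₃ :* q₂) :* x₁ :+ (p₃ :* q₁ :- p₁ :* q₃) :* x₂ :+ (p₁ :* q₂ :- p₂ :* q₁) :* x₃)
      refl p₁ p₂ p₃ q₁ q₂ q₃ x₁ x₂ x₃

  det3-repeated : ∀ P Q → (det3 P Q P ≈ 0#) × (det3 P Q Q ≈ 0#)
  det3-repeated (p₁ , p₂ , p₃) (q₁ , q₂ , q₃) =
      solve 6 (λ p₁ p₂ p₃ q₁ q₂ q₃ →
        ((p₁ :* ((q₂ :* p₃) :- (q₃ :* p₂))) :- (p₂ :* ((q₁ :* p₃) :- (q₃ :* p₁))))
          :+ (p₃ :* ((q₁ :* p₂) :- (q₂ :* p₁)))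
        := con (+ 0)) refl p₁ p₂ p₃ q₁ q₂ q₃
    , solve 6 (λ p₁ p₂ p₃ q₁ q₂ q₃ →
        ((p₁ :* ((q₂ :* q₃) :- (q₃ :* q₂))) :- (p₂ :* ((q₁ :* q₃) :- (q₃ :* q₁))))
          :+ (p₃ :* ((q₁ :* q₂) :- (q₂ :* q₁)))
        := con (+ 0)) refl p₁ p₂ p₃ q₁ q₂ q₃

  dot-scale : ∀ {ℓ₁ ℓ₂ ℓ₃ w₁ w₂ w₃} t → ℓ₁ ≈ t * w₁ → ℓ₂ ≈ t * w₂ → ℓ₃ ≈ t * w₃ →
              ∀ X → dot (ℓ₁ , ℓ₂ , ℓ₃) X ≈ t * dot (w₁ , w₂ , w₃) X
  dot-scale {w₁ = w₁} {w₂} {w₃} t ℓ₁≈ ℓ₂≈ ℓ₃≈ (x₁ , x₂ , x₃) =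
    trans (+-cong (+-cong (*-congʳ ℓ₁≈) (*-congʳ ℓ₂≈)) (*-congʳ ℓ₃≈))
          (solve 7 (λ t w₁ w₂ w₃ x₁ x₂ x₃ → (t :* w₁) :* x₁ :+ (t :* w₂) :* x₂ :+ (t :* w₃) :* x₃
                                           := t :* (w₁ :* x₁ :+ w₂ :* x₂ :+ w₃ :* x₃))
                 refl t w₁ w₂ w₃ x₁ x₂ x₃)

  normalize : ∀ w → ¬ IsZero3 w → Σ Line λ L → Σ Carrier λ t → ∀ X → dot (coordsₗ L) X ≈ t * dot w X
  normalize (w₁ , w₂ , w₃) w≉0 with w₁ ≈? 0# | w₂ ≈? 0# | w₃ ≈? 0#
  ... | no w₁≉0 | _ | _ with inverse w₁ w₁≉0
  ...   | t , w₁t≈1 with enum-sur (t * w₂) | enum-sur (t * w₃)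
  ...     | a , a↦tw₂ | b , b↦tw₃ =
    ⟨1, a , b ⟩ , t , dot-scale t (sym (trans (*-comm t w₁) w₁t≈1)) a↦tw₂ b↦tw₃
  normalize (w₁ , w₂ , w₃) w≉0 | yes w₁≈0 | no w₂≉0 | _ with inverse w₂ w₂≉0
  ...   | t , w₂t≈1 with enum-sur (t * w₃)
  ...     | a , a↦tw₃ =
    ⟨0,1, a ⟩ , t ,
    dot-scale t (sym (trans (*-congˡ w₁≈0) (zeroʳ t))) (sym (trans (*-comm t w₂) w₂t≈1)) a↦tw₃
  normalize (w₁ , w₂ , w₃) w≉0 | yes w₁≈0 | yes w₂≈0 | no w₃≉0 with inverse w₃ w₃≉0
  ...   | t , w₃t≈1 =
    ⟨0,0,1⟩ , t , dot-scale t (sym (trans (*-congˡ w₁≈0) (zeroʳ t))) (sym (trans (*-congˡ w₂≈0) (zeroʳ t)))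
                            (sym (trans (*-comm t w₃) w₃t≈1))
  normalize (w₁ , w₂ , w₃) w≉0 | yes w₁≈0 | yes w₂≈0 | yes w₃≈0 = contradiction (w₁≈0 , w₂≈0 , w₃≈0) w≉0

  line-through : ∀ {P Q R} → ¬ Collinear P Q R → Σ Line λ L → L ∋ P × L ∋ Q
  line-through {P} {Q} {R} PQR≉0 = through-P-Q (normalize (cross p₀ q₀) w≉0)
    where
    p₀ q₀ : Vec3
    p₀ = coords P
    q₀ = coords Q
    w≉0 : ¬ IsZero3 (cross p₀ q₀)
    w≉0 (w₁≈0 , w₂≈0 , w₃≈0) = PQR≉0 (trans (det3≈dot-cross p₀ q₀ (coords R))
      (trans (+-cong (+-cong (trans (*-congʳ w₁≈0) (zeroˡ _)) (trans (*-congʳ w₂≈0) (zeroˡ _)))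
                     (trans (*-congʳ w₃≈0) (zeroˡ _)))
             (trans (+-identityʳ _) (+-identityʳ _))))
    through-P-Q : (Σ Line λ L → Σ Carrier λ t → ∀ X → dot (coordsₗ L) X ≈ t * dot (cross p₀ q₀) X) →
                  Σ Line λ L → L ∋ P × L ∋ Q
    through-P-Q (L , t , ℓ≈tw) =
      L , through (proj₁ (det3-repeated p₀ q₀)) , through (proj₂ (det3-repeated p₀ q₀))
      where
      through : ∀ {X} → det3 p₀ q₀ X ≈ 0# → dot (coordsₗ L) X ≈ 0#
      through {X} det≈0 =
        trans (ℓ≈tw X) (trans (*-congˡ (trans (sym (det3≈dot-cross p₀ q₀ X)) det≈0)) (zeroʳ t))

  lines-through-two-points : ∀ {P Q R} → ¬ Collinear P Q R → Σₗ (λ L → χ L P ℕ.* χ L Q) ≡ 1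
  lines-through-two-points {P} {Q} {R} PQR≉0 = count (line-through {P} {Q} {R} PQR≉0)
    where
    count : (Σ Line λ L → L ∋ P × L ∋ Q) → Σₗ (λ L → χ L P ℕ.* χ L Q) ≡ 1
    count (L₀ , L₀∋P , L₀∋Q) =
      ≡.trans (Σₗ-single L₀ others) (≡.cong₂ ℕ._*_ (𝟙-yes (L₀ ∋? P) L₀∋P) (𝟙-yes (L₀ ∋? Q) L₀∋Q))
      where
      others : ∀ L → L ≢ L₀ → χ L P ℕ.* χ L Q ≡ 0
      others L L≢L₀ with L ∋? P | L ∋? Q
      ... | yes L∋P | yes L∋Q =
        contradiction (line-unique {L} {L₀} {P} {Q} {R} PQR≉0 L∋P L∋Q L₀∋P L₀∋Q) L≢L₀
      ... | yes _   | no _    = ≡.refl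
      ... | no _    | _       = ≡.refl

module LocalArcCount {q : ℕ} (F : FiniteField q) {k m : ℕ} (S : Fin m → Fin k → PG2.Point F)
                     (isLocalArc : PG2.IsUniformLocalArc F k m S) (2≤k : 2 ≤ k) (2≤m : 2 ≤ m) where
  open import Data.Nat.Base as ℕ using (zero; suc; s≤s; z≤n; _+_; _*_)
  import Data.Nat.Properties as ℕ
  open import Data.Nat.Tactic.RingSolver using (solve-∀)
  open import Data.Fin.Base as Fin using (zero; suc; splitAt)
  import Data.Fin.Properties as Fin
  open import Data.Product.Base using (Σ; ∃; _×_; _,_; proj₁; proj₂)
  open import Data.Sum.Base using (_⊎_; inj₁; inj₂; [_,_]′)
  open import Data.Sum.Properties using (inj₁-injective)
  open import Function.Base using (_∘_)
  open import Relation.Binary.PropositionalEquality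
  open import Relation.Nullary using (¬_; Dec; yes; no; ¬?; _×-dec_)
  open import Relation.Nullary.Negation using (contradiction)
  import Data.Integer.Base as ℤ
  open IntegerBound using (arcQuadratic; counts⇒arcQuadratic)

  open PG2 F using (Point; Collinear)
  open NatSum
  open ProjectivePlane F

  another : ∀ {n} → 2 ≤ n → (i : Fin n) → Σ (Fin n) (i ≢_)
  another (s≤s (s≤s _)) zero    = suc zero , λ ()
  another (s≤s (s≤s _)) (suc i) = zero , λ ()

  member : Fin m → Fin m → Fin k ⊎ Fin k → Point
  member j j′ = [ S j , S j′ ]′

  noncollinear : ∀ {j j′} → j ≢ j′ → ∀ x y z → x ≢ y → y ≢ z → x ≢ z →
                 ¬ Collinear (member j j′ x) (member j j′ y) (member j j′ z)
  noncollinear {j} {j′} j≢j′ x y z x≢y y≢z x≢z =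
    subst (λ (P , Q , R) → ¬ Collinear P Q R) (cong₂ _,_ (pick x) (cong₂ _,_ (pick y) (pick z)))
      (proj₂ (proj₂ (proj₂ isLocalArc j j′ j≢j′)) (join x) (join y) (join z)
        (x≢y ∘ join-injective) (y≢z ∘ join-injective) (x≢z ∘ join-injective))
    where
    open import Data.Vec.Functional using (_++_)
    join : Fin k ⊎ Fin k → Fin (k + k)
    join = Fin.join k k
    join-injective : ∀ {x y} → join x ≡ join y → x ≡ y
    join-injective {x} {y} eq =
      trans (sym (Fin.splitAt-join k k x)) (trans (cong (splitAt k) eq) (Fin.splitAt-join k k y))
    pick : ∀ x → (S j ++ S j′) (join x) ≡ member j j′ x
    pick x = cong [ S j , S j′ ]′ (Fin.splitAt-join k k x)

  pair-in-member : ∀ j {a b} → a ≢ b → Σₗ (λ L → χ L (S j a) * χ L (S j b)) ≡ 1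
  pair-in-member j {a} {b} a≢b with another 2≤m j
  ... | j′ , j≢j′ = lines-through-two-points {S j a} {S j b} {S j′ a}
    (noncollinear j≢j′ (inj₁ a) (inj₁ b) (inj₂ a) (a≢b ∘ inj₁-injective) (λ ()) (λ ()))

  pair-across : ∀ {j j′} → j ≢ j′ → ∀ a b → Σₗ (λ L → χ L (S j a) * χ L (S j′ b)) ≡ 1
  pair-across {j} {j′} j≢j′ a b with another 2≤k a
  ... | c , a≢c = lines-through-two-points {S j a} {S j′ b} {S j c}
    (noncollinear j≢j′ (inj₁ a) (inj₂ b) (inj₁ c) (λ ()) (λ ()) (a≢c ∘ inj₁-injective))

  on : Line → Fin m → Fin k → ℕ
  on L j a = χ L (S j a)

  meet : Line → Fin m → ℕ
  meet L j = ∑[ a < k ] on L j a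

  size : Line → ℕ
  size L = ∑[ j < m ] meet L j

  onBoth : Line → Fin m → Fin k → Fin k → ℕ
  onBoth L j a b = on L j a * on L j b

  innerPairs : Line → ℕ
  innerPairs L = ∑[ j < m ] offDiag (onBoth L j)

  crossPairs : Line → ℕ
  crossPairs L = offDiag (λ j j′ → meet L j * meet L j′)

  size² : ∀ L → size L * size L ≡ size L + innerPairs L + crossPairs L
  size² L = begin
    size L * size L
      ≡⟨ sum*sum (meet L) (meet L) ⟩
    ∑[ j < m ] ∑[ j′ < m ] (meet L j * meet L j′)
      ≡⟨ ∑∑-diagonal+offDiag (λ j j′ → meet L j * meet L j′) ⟩
    ∑[ j < m ] (meet L j * meet L j) + crossPairs L
      ≡⟨ cong (_+ crossPairs L) (sum-cong-≗ meet²) ⟩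
    ∑[ j < m ] (meet L j + offDiag (onBoth L j)) + crossPairs L
      ≡⟨ cong (_+ crossPairs L) (∑-distrib-+ (meet L) (λ j → offDiag (onBoth L j))) ⟩
    size L + innerPairs L + crossPairs L
      ∎
    where
    open ≡-Reasoning
    meet² : ∀ j → meet L j * meet L j ≡ meet L j + offDiag (onBoth L j)
    meet² j = begin
      meet L j * meet L j                                 ≡⟨ sum*sum (on L j) (on L j) ⟩
      ∑[ a < k ] ∑[ b < k ] onBoth L j a b                 ≡⟨ ∑∑-diagonal+offDiag (onBoth L j) ⟩
      ∑[ a < k ] onBoth L j a a + offDiag (onBoth L j)    ≡⟨ cong (_+ offDiag (onBoth L j))
                                                                 (sum-cong-≗ λ a → 𝟙*𝟙≡𝟙 (L ∋? S j a)) ⟩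
      meet L j + offDiag (onBoth L j)                     ∎

  Secant : Line → Set
  Secant L = ∃ λ j → ∃ λ a → ∃ λ b → a ≢ b × L ∋ S j a × L ∋ S j b

  secant? : ∀ L → Dec (Secant L)
  secant? L = Fin.any? λ j → Fin.any? λ a → Fin.any? λ b →
                ¬? (a Fin.≟ b) ×-dec (L ∋? S j a) ×-dec (L ∋? S j b)

  secant-line : ∀ L → Secant L → size L ≡ 2 × innerPairs L ≡ 2 × crossPairs L ≡ 0
  secant-line L (j , a , b , a≢b , L∋a , L∋b) = size≡2 , inner≡2 , cross≡0
    where
    misses-other-members : ∀ {j′} → j′ ≢ j → meet L j′ ≡ 0
    misses-other-members {j′} j′≢j = ∑-zero λ c → 𝟙-no (L ∋? S j′ c) λ L∋c →
      noncollinear (j′≢j ∘ sym) (inj₁ a) (inj₁ b) (inj₂ c) (a≢b ∘ inj₁-injective) (λ ()) (λ ())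
        (∋-collinear {L} {S j a} {S j b} {S j′ c} L∋a L∋b L∋c)
    no-third-point : ∀ c → c ≢ a → c ≢ b → on L j c ≡ 0
    no-third-point c c≢a c≢b with another 2≤m j
    ... | j′ , j≢j′ = 𝟙-no (L ∋? S j c) λ L∋c →
      noncollinear j≢j′ (inj₁ a) (inj₁ b) (inj₁ c)
        (a≢b ∘ inj₁-injective) (c≢b ∘ sym ∘ inj₁-injective) (c≢a ∘ sym ∘ inj₁-injective)
        (∋-collinear {L} {S j a} {S j b} {S j c} L∋a L∋b L∋c)
    size≡2 : size L ≡ 2
    size≡2 = trans (∑-single j λ j′ → misses-other-members)
                   (trans (∑-pair a b a≢b no-third-point)
                          (cong₂ _+_ (𝟙-yes (L ∋? S j a) L∋a) (𝟙-yes (L ∋? S j b) L∋b)))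
    cross≡0 : crossPairs L ≡ 0
    cross≡0 = offDiag-zero λ j₁ j₂ j₁≢j₂ → vanish j₁ j₂ j₁≢j₂ (j₁ Fin.≟ j)
      where
      vanish : ∀ j₁ j₂ → j₁ ≢ j₂ → Dec (j₁ ≡ j) → meet L j₁ * meet L j₂ ≡ 0
      vanish j₁ j₂ j₁≢j₂ (yes refl) =
        trans (cong (meet L j₁ *_) (misses-other-members (j₁≢j₂ ∘ sym))) (ℕ.*-zeroʳ (meet L j₁))
      vanish j₁ j₂ _     (no j₁≢j)  = cong (_* meet L j₂) (misses-other-members j₁≢j)
    inner≡2 : innerPairs L ≡ 2
    inner≡2 = ℕ.+-cancelˡ-≡ 2 (innerPairs L) 2 (sym (trans four (ℕ.+-identityʳ _)))
      where
      four : 2 * 2 ≡ 2 + innerPairs L + 0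
      four = subst₂ (λ s c → s * s ≡ s + innerPairs L + c) size≡2 cross≡0 (size² L)

  non-secant-line : ∀ L → ¬ Secant L → innerPairs L ≡ 0
  non-secant-line L ¬secant =
    ∑-zero λ j → offDiag-zero λ a b a≢b → no-pair j a b a≢b (L ∋? S j a) (L ∋? S j b)
    where
    no-pair : ∀ j a b → a ≢ b → (da : Dec (L ∋ S j a)) (db : Dec (L ∋ S j b)) →
              𝟙 da * 𝟙 db ≡ 0
    no-pair j a b a≢b (yes L∋a) (yes L∋b) = contradiction (j , a , b , a≢b , L∋a , L∋b) ¬secant
    no-pair j a b a≢b (yes _)   (no _)    = refl
    no-pair j a b a≢b (no _)    _         = refl

  nonsecant : Line → ℕ
  nonsecant L = 𝟙 (¬? (secant? L))

  2*nonsecant+innerPairs≡2 : ∀ L → 2 * nonsecant L + innerPairs L ≡ 2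
  2*nonsecant+innerPairs≡2 L = cases (secant? L)
    where
    cases : (d : Dec (Secant L)) → 2 * 𝟙 (¬? d) + innerPairs L ≡ 2
    cases (yes secant) = proj₁ (proj₂ (secant-line L secant))
    cases (no ¬secant) = cong (2 +_) (non-secant-line L ¬secant)

  nonsecant*size+innerPairs≡size : ∀ L → nonsecant L * size L + innerPairs L ≡ size L
  nonsecant*size+innerPairs≡size L = cases (secant? L)
    where
    cases : (d : Dec (Secant L)) → 𝟙 (¬? d) * size L + innerPairs L ≡ size L
    cases (yes secant) =
      let (size≡2 , inner≡2 , _) = secant-line L secant in trans inner≡2 (sym size≡2)
    cases (no ¬secant) = trans (cong (1 * size L +_) (non-secant-line L ¬secant))
                               (trans (ℕ.+-identityʳ (1 * size L)) (ℕ.*-identityˡ (size L)))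

  nonsecant*size²≤nonsecant*size+crossPairs : ∀ L →
    nonsecant L * (size L * size L) ≤ nonsecant L * size L + crossPairs L
  nonsecant*size²≤nonsecant*size+crossPairs L = cases (secant? L)
    where
    cases : (d : Dec (Secant L)) → 𝟙 (¬? d) * (size L * size L) ≤ 𝟙 (¬? d) * size L + crossPairs L
    cases (yes secant) = z≤n
    cases (no ¬secant) = ℕ.≤-reflexive (begin
      1 * (size L * size L)                 ≡⟨ ℕ.*-identityˡ _ ⟩
      size L * size L                       ≡⟨ size² L ⟩
      size L + innerPairs L + crossPairs L  ≡⟨ cong (λ i → size L + i + crossPairs L)
                                                    (non-secant-line L ¬secant) ⟩
      1 * size L + crossPairs L             ∎)
      where open ≡-Reasoning

  Σₗ-size : Σₗ size ≡ m * k * (q + 1)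
  Σₗ-size = begin
    Σₗ size                                        ≡⟨ ∑-comm (λ i j → meet (line i) j) ⟩
    ∑[ j < m ] Σₗ (λ L → meet L j)                  ≡⟨ sum-cong-≗ (λ j → ∑-comm λ i a → on (line i) j a) ⟩
    ∑[ j < m ] ∑[ a < k ] Σₗ (λ L → χ L (S j a))    ≡⟨ sum-cong-≗ (λ j → sum-cong-≗ λ a →
                                                                   lines-through-point (S j a)) ⟩
    ∑[ j < m ] ∑[ a < k ] (q + 1)                  ≡⟨ trans (sum-cong-≗ {m} λ j → ∑-const k (q + 1))
                                                            (∑-const m (k * (q + 1))) ⟩
    m * (k * (q + 1))                              ≡⟨ ℕ.*-assoc m k (q + 1) ⟨
    m * k * (q + 1)                                ∎
    where open ≡-Reasoning

  Σₗ-innerPairs : Σₗ innerPairs + m * k ≡ m * k * k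
  Σₗ-innerPairs = begin
    Σₗ innerPairs + m * k    ≡⟨ cong (_+ m * k) count ⟩
    m * D + m * k            ≡⟨ factor m D k ⟩
    m * (D + k * 1)          ≡⟨ cong (m *_) (offDiag-const k 1) ⟩
    m * (k * k * 1)          ≡⟨ unfactor m k ⟩
    m * k * k                ∎
    where
    open ≡-Reasoning
    D : ℕ
    D = offDiag {k} (λ _ _ → 1)
    factor : ∀ m D k → m * D + m * k ≡ m * (D + k * 1)
    factor = solve-∀
    unfactor : ∀ m k → m * (k * k * 1) ≡ m * k * k
    unfactor = solve-∀
    count : Σₗ innerPairs ≡ m * D
    count = begin
      Σₗ innerPairs                               ≡⟨ ∑-comm (λ i j → offDiag (onBoth (line i) j)) ⟩
      ∑[ j < m ] Σₗ (λ L → offDiag (onBoth L j))   ≡⟨ sum-cong-≗ (λ j → ∑-offDiag λ i → onBoth (line i) j) ⟩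
      ∑[ j < m ] offDiag (λ a b → Σₗ (λ L → onBoth L j a b))
                                                  ≡⟨ sum-cong-≗ (λ j → offDiag-cong λ a b → pair-in-member j) ⟩
      ∑[ j < m ] D                                ≡⟨ ∑-const m D ⟩
      m * D                                       ∎

  Σₗ-crossPairs : Σₗ crossPairs + m * k * k ≡ m * k * (m * k)
  Σₗ-crossPairs = begin
    Σₗ crossPairs + m * k * k                   ≡⟨ cong₂ _+_ count (ℕ.*-assoc m k k) ⟩
    offDiag {m} (λ _ _ → k * k) + m * (k * k)   ≡⟨ offDiag-const m (k * k) ⟩
    m * m * (k * k)                             ≡⟨ interchange m k ⟩
    m * k * (m * k)                             ∎
    where
    open ≡-Reasoning
    interchange : ∀ m k → m * m * (k * k) ≡ m * k * (m * k)
    interchange = solve-∀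
    meet*meet : ∀ {j j′} → j ≢ j′ → Σₗ (λ L → meet L j * meet L j′) ≡ k * k
    meet*meet {j} {j′} j≢j′ = begin
      Σₗ (λ L → meet L j * meet L j′)
        ≡⟨ sum-cong-≗ (λ i → sum*sum (on (line i) j) (on (line i) j′)) ⟩
      Σₗ (λ L → ∑[ a < k ] ∑[ b < k ] (on L j a * on L j′ b))
        ≡⟨ ∑-comm (λ i a → ∑[ b < k ] (on (line i) j a * on (line i) j′ b)) ⟩
      ∑[ a < k ] Σₗ (λ L → ∑[ b < k ] (on L j a * on L j′ b))
        ≡⟨ sum-cong-≗ (λ a → ∑-comm λ i b → on (line i) j a * on (line i) j′ b) ⟩
      ∑[ a < k ] ∑[ b < k ] Σₗ (λ L → on L j a * on L j′ b)
        ≡⟨ sum-cong-≗ (λ a → sum-cong-≗ λ b → pair-across j≢j′ a b) ⟩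
      ∑[ a < k ] ∑[ b < k ] 1
        ≡⟨ trans (sum-cong-≗ {k} λ a → trans (∑-const k 1) (ℕ.*-identityʳ k)) (∑-const k k) ⟩
      k * k
        ∎
    count : Σₗ crossPairs ≡ offDiag {m} (λ _ _ → k * k)
    count = trans (∑-offDiag λ i j j′ → meet (line i) j * meet (line i) j′)
                  (offDiag-cong λ j j′ → meet*meet)

  μ₀ μ₁ μ₂ : ℕ
  μ₀ = Σₗ nonsecant
  μ₁ = Σₗ (λ L → nonsecant L * size L)
  μ₂ = Σₗ (λ L → nonsecant L * (size L * size L))

  2μ₀+Σinner≡2N : 2 * μ₀ + Σₗ innerPairs ≡ 2 * lineCount
  2μ₀+Σinner≡2N = begin
    2 * μ₀ + Σₗ innerPairs
      ≡⟨ cong (_+ Σₗ innerPairs) (∑-*ˡ 2 (nonsecant ∘ line)) ⟨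
    Σₗ (λ L → 2 * nonsecant L) + Σₗ innerPairs
      ≡⟨ ∑-distrib-+ (λ i → 2 * nonsecant (line i)) (innerPairs ∘ line) ⟨
    Σₗ (λ L → 2 * nonsecant L + innerPairs L)
      ≡⟨ sum-cong-≗ (2*nonsecant+innerPairs≡2 ∘ line) ⟩
    Σₗ (λ _ → 2)
      ≡⟨ trans (∑-const lineCount 2) (ℕ.*-comm lineCount 2) ⟩
    2 * lineCount
      ∎
    where open ≡-Reasoning

  μ₁+Σinner≡Σsize : μ₁ + Σₗ innerPairs ≡ m * k * (q + 1)
  μ₁+Σinner≡Σsize =
    trans (sym (∑-distrib-+ (λ i → nonsecant (line i) * size (line i)) (innerPairs ∘ line)))
          (trans (sum-cong-≗ (nonsecant*size+innerPairs≡size ∘ line)) Σₗ-size)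

  μ₂≤μ₁+Σcross : μ₂ ≤ μ₁ + Σₗ crossPairs
  μ₂≤μ₁+Σcross =
    ℕ.≤-trans (∑-mono-≤ (nonsecant*size²≤nonsecant*size+crossPairs ∘ line))
              (ℕ.≤-reflexive (∑-distrib-+ (λ i → nonsecant (line i) * size (line i)) (crossPairs ∘ line)))

  μ₁²≤μ₀μ₂ : μ₁ * μ₁ ≤ μ₀ * μ₂
  μ₁²≤μ₀μ₂ = subst₂ _≤_ (cong₂ _*_ Σnonsecant²*size≡μ₁ Σnonsecant²*size≡μ₁)
                       (cong₂ _*_ (sum-cong-≗ (nonsecant²≡nonsecant ∘ line)) Σ[nonsecant*size]²≡μ₂)
                       (Cauchy–Schwarz (nonsecant ∘ line) (λ i → nonsecant (line i) * size (line i)))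
    where
    nonsecant²≡nonsecant : ∀ L → nonsecant L * nonsecant L ≡ nonsecant L
    nonsecant²≡nonsecant L = 𝟙*𝟙≡𝟙 (¬? (secant? L))
    Σnonsecant²*size≡μ₁ : Σₗ (λ L → nonsecant L * (nonsecant L * size L)) ≡ μ₁
    Σnonsecant²*size≡μ₁ = sum-cong-≗ λ i →
      trans (sym (ℕ.*-assoc (nonsecant (line i)) _ _)) (cong (_* size (line i)) (nonsecant²≡nonsecant (line i)))
    Σ[nonsecant*size]²≡μ₂ : Σₗ (λ L → (nonsecant L * size L) * (nonsecant L * size L)) ≡ μ₂
    Σ[nonsecant*size]²≡μ₂ = sum-cong-≗ λ i →
      trans (rearrange (nonsecant (line i)) (size (line i)))
            (cong (_* (size (line i) * size (line i))) (nonsecant²≡nonsecant (line i)))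
      where
      rearrange : ∀ e s → (e * s) * (e * s) ≡ (e * e) * (s * s)
      rearrange = solve-∀

  arcQuadratic-nonneg : ℤ.0ℤ ℤ.≤ arcQuadratic (ℤ.+ k) (ℤ.+ q) (ℤ.+ (m * k))
  arcQuadratic-nonneg = counts⇒arcQuadratic {E = μ₀} {S = μ₁} {X = Σₗ crossPairs} {Z = Σₗ innerPairs}
    (ℕ.<-≤-trans (s≤s z≤n) (ℕ.*-mono-≤ 2≤m 2≤k)) 2μ₀+Σinner≡2N μ₁+Σinner≡Σsize Σₗ-innerPairs Σₗ-crossPairs
    (ℕ.≤-trans μ₁²≤μ₀μ₂ (ℕ.*-monoʳ-≤ μ₀ μ₂≤μ₁+Σcross))

open import Data.Nat using (ℕ; _≤_; _*_; _≤?_; ≤-pred)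
open import Data.Nat.Properties using (≰⇒>)
open import Data.Fin using (Fin)
open import Data.Integer as ℤ using (ℤ; +_)
open import Data.Integer.Properties using (≤-trans)
open import Relation.Nullary using (Dec; yes; no)
open IntegerBound using (1≤floor; arcQuadratic⇒≤floor; +m≤f⇒+[m*k]≤+k*f)
open ProjectivePlane using (2≤q)
open LocalArcCount using (arcQuadratic-nonneg)

theorem2p3 : (q : ℕ) (F : FiniteField q) (k : ℕ) → 2 ≤ k →
    (m : ℕ) (S : Fin m → Fin k → PG2.Point F) →
    PG2.IsUniformLocalArc F k m S →
    + 0 ℤ.≤ boundB k q →
    (f : ℤ) → IsFloorOfSqrtExpr (boundA k q) (boundB k q) (boundC k) f →
    + (m * k) ℤ.≤ + k ℤ.* f
theorem2p3 q F k 2≤k m S isLocalArc 0≤B f isFloor = +m≤f⇒+[m*k]≤+k*f k (m≤f (2 ≤? m))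
  where
  m≤f : Dec (2 ≤ m) → + m ℤ.≤ f
  m≤f (yes 2≤m) = arcQuadratic⇒≤floor m 2≤k (arcQuadratic-nonneg F S isLocalArc 2≤k 2≤m) isFloor
  m≤f (no m≱2)  = ≤-trans (ℤ.+≤+ (≤-pred (≰⇒> m≱2))) (1≤floor 2≤k (2≤q F) 0≤B isFloor)
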